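{- For all positive integers $k,\ell,n$, \[ (-1)^{\ell-1}\left(\sum_{j=-(\ell-1)}^{\ell} (-1)^j\, b_k\!\left(n-\tfrac{j(3j-1)}{2}\right)-\frac{1+(-1)^{[n \equiv 0 \pmod k]+1}}{2}\cdot \frac{n}{k} \right)\geq 0. \]
   Context: A partition of $n$ is a weakly decreasing finite sequence of positive integers summing to $n$. $b_k(n)$ (for $n\ge1$) is the sum, over all partitions $\lambda$ of $n$, of the sum of the distinct part values of $\lambda$ that appear at least $k$ times in $\lambda$; $b_k(m)=0$ for $m\le 0$. $[P]$ is the Iverson bracket: $1$ if $P$ holds, $0$ otherwise. -}

module Defs where

open import Data.Nat as ℕ using (ℕ; zero; suc; _≥_; _≤?_; _≥?_)
open import Data.Nat.Properties using () renaming (_≟_ to _≟ℕ_)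
open import Data.Nat.Divisibility using (_∣?_)
open import Data.Integer as ℤ using (ℤ; +_; -[1+_]; ∣_∣)
open import Data.List using (List; []; _∷_; map; concatMap; filter; upTo)
open import Data.Nat.ListAction using (sum)
open import Data.List.Relation.Unary.Linked using (Linked; linked?)
open import Data.Product using (_×_)
open import Relation.Nullary using (does)
open import Relation.Nullary.Decidable using (_×-dec_)
open import Relation.Binary.PropositionalEquality using (_≡_)
open import Data.Bool using (if_then_else_)

IsPartition : ℕ → List ℕ → Set
IsPartition n λ′ = Linked _≥_ λ′ × sum λ′ ≡ n

isPartition? : ∀ n λ′ → Relation.Nullary.Dec (IsPartition n λ′)
isPartition? n λ′ = linked? (λ x y → x ≥? y) λ′ ×-dec (sum λ′ ≟ℕ n)
  where import Relation.Nullary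

listsOfLength : List ℕ → ℕ → List (List ℕ)
listsOfLength xs zero = [] ∷ []
listsOfLength xs (suc m) = concatMap (λ x → map (x ∷_) (listsOfLength xs m)) xs

-- candidate lists: entries in {1,…,n}, length ≤ n (every partition of n is among them, once)
candidates : ℕ → List (List ℕ)
candidates n = concatMap (listsOfLength (map suc (upTo n))) (upTo (suc n))

partitions : ℕ → List (List ℕ)
partitions n = filter (isPartition? n) (candidates n)

count : ℕ → List ℕ → ℕ
count v [] = 0
count v (x ∷ xs) = if does (v ≟ℕ x) then suc (count v xs) else count v xs

-- sum of the distinct part values of λ′ (all values lie in 1..n) appearing at least k times
sumParts≥ : ℕ → ℕ → List ℕ → ℕ
sumParts≥ k n λ′ = sum (map (λ v → if does (count v λ′ ≥? k) then v else 0) (map suc (upTo n)))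

-- b_k(n) for n ≥ 1 (b_k(0) = 0 automatically, matching the convention)
bℕ : ℕ → ℕ → ℕ
bℕ k n = sum (map (sumParts≥ k n) (partitions n))

b : ℕ → ℤ → ℤ
b k (+ zero) = + 0
b k (+ suc m) = + bℕ k (suc m)
b k -[1+ m ] = + 0

iverson-dvd : ℕ → ℕ → ℕ
iverson-dvd k n = if does (k ∣? n) then 1 else 0

-- j(3j-1)/2 (always an exact integer division)
pent : ℤ → ℤ
pent j = (j ℤ.* (+ 3 ℤ.* j ℤ.- + 1)) ℤ./ + 2

signPow : ℤ → ℤ
signPow j = (ℤ.- (+ 1)) ℤ.^ ∣ j ∣

range : ℕ → List ℤ
range ℓ = map (λ i → + i ℤ.- + (ℓ ℕ.∸ 1)) (upTo (2 ℕ.* ℓ))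

sumℤ : List ℤ → ℤ
sumℤ [] = + 0
sumℤ (x ∷ xs) = x ℤ.+ sumℤ xs

-- Since b_k(n) = Σ_{v ≥ 1} v p(n - k v) (adding or removing k copies of the part v),
-- the alternating sum equals Σ_{v ≥ 1} v T_ℓ(n - k v), where
-- T_ℓ(m) = Σ_{j=-(ℓ-1)}^{ℓ} (-1)^j p(m - j(3j-1)/2) is the truncated pentagonal sum,
-- while the subtracted term is Σ_{v ≥ 1} v [n = k v]. It therefore suffices that
-- (-1)^(ℓ-1) (T_ℓ(m) - [m = 0]) ≥ 0 for all m (Andrews and Merca).
-- For this we use the series g_s = 1 / (q^s; q)_∞ of partitions into parts ≥ s, which
-- satisfy g_s = g_(s+1) / (1 - q^s). The number (-1)^(ℓ-1) (T_ℓ(m) - [m = 0]) is the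
-- coefficient of q^m, at s = ℓ + 1, of
--   R_s = Σ_{i<ℓ} (-1)^(ℓ-1-i) q^(s i + i(i-1)/2) g_s / (q; q)_i - (-1)^(ℓ-1),
-- and the recursion for g_s gives R_s = R_(s+1) + q^s W_(s+1) / (1 - q^s), where W_(s+1) is
-- the summand i = ℓ - 1 of R_(s+1). As R_s vanishes below degree s, unrolling this recursion
-- writes each coefficient of R_s as a finite sum of nonnegative numbers.

{-# OPTIONS --safe #-}
module Submission where

module PowerSeries where

  open import Data.Nat as ℕ using (ℕ; zero; suc; _<_; s≤s)
  import Data.Nat.Properties as ℕₚ
  open import Data.Nat.Induction using (<-rec)
  open import Data.Integer using (ℤ; +_; _+_; _-_; _≤_; +≤+)
  open import Data.Integer.Properties using (+-identityˡ; +-identityʳ; +-inverseʳ; +-mono-≤)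
  open import Data.Integer.Tactic.RingSolver using (solve-∀)
  open import Relation.Binary.Bundles using (Setoid)
  open import Relation.Binary.PropositionalEquality
  import Relation.Binary.Reasoning.Setoid as SetoidReasoning
  open ≡-Reasoning

  Series : Set
  Series = ℕ → ℤ

  open Setoid (ℕ →-setoid ℤ) public
    using () renaming (refl to ≗-refl; sym to ≗-sym; trans to ≗-trans)

  module ≗-Reasoning = SetoidReasoning (ℕ →-setoid ℤ)

  infixl 6 _⊕_ _⊖_

  _⊕_ _⊖_ : Series → Series → Series
  (F ⊕ G) n = F n + G n
  (F ⊖ G) n = F n - G n

  𝟘 𝟙 : Series
  𝟘 n = + 0
  𝟙 zero = + 1
  𝟙 (suc n) = + 0

  shift : ℕ → Series → Series
  shift zero F n = F n
  shift (suc a) F zero = + 0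
  shift (suc a) F (suc n) = shift a F n

  -- `mulFactor m` and `divFactor m` multiply and divide by 1 - q^(1+m) (the offset keeps
  -- the exponent positive); the coefficient of q^n in F / (1 - q^(1+m)) only involves
  -- the first n + 1 terms of the geometric series.
  mulFactor : ℕ → Series → Series
  mulFactor m F = F ⊖ shift (suc m) F

  geometricPartialSum : ℕ → Series → ℕ → Series
  geometricPartialSum m F zero n = + 0
  geometricPartialSum m F (suc K) n = geometricPartialSum m F K n + shift (K ℕ.* suc m) F n

  divFactor : ℕ → Series → Series
  divFactor m F n = geometricPartialSum m F (suc n) n

  shift-+ : ∀ a x F → shift a F (a ℕ.+ x) ≡ F x
  shift-+ zero x F = refl
  shift-+ (suc a) x F = shift-+ a x F

  shift-< : ∀ a n F → n < a → shift a F n ≡ + 0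
  shift-< (suc a) zero F _ = refl
  shift-< (suc a) (suc n) F (s≤s n<a) = shift-< a n F n<a

  shift-ext : ∀ a n {F G} → (∀ x → n ≡ a ℕ.+ x → F x ≡ G x) → shift a F n ≡ shift a G n
  shift-ext zero n eq = eq n refl
  shift-ext (suc a) zero eq = refl
  shift-ext (suc a) (suc n) eq = shift-ext a n (λ x e → eq x (cong suc e))

  shift-cong : ∀ a {F G} → F ≗ G → shift a F ≗ shift a G
  shift-cong a eq n = shift-ext a n (λ x _ → eq x)

  shift-≡ : ∀ {a b} F → a ≡ b → shift a F ≗ shift b F
  shift-≡ F refl n = refl

  shift-⊕ : ∀ a F G → shift a (F ⊕ G) ≗ shift a F ⊕ shift a G
  shift-⊕ zero F G n = refl
  shift-⊕ (suc a) F G zero = refl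
  shift-⊕ (suc a) F G (suc n) = shift-⊕ a F G n

  shift-⊖ : ∀ a F G → shift a (F ⊖ G) ≗ shift a F ⊖ shift a G
  shift-⊖ zero F G n = refl
  shift-⊖ (suc a) F G zero = refl
  shift-⊖ (suc a) F G (suc n) = shift-⊖ a F G n

  shift-𝟘 : ∀ a → shift a 𝟘 ≗ 𝟘
  shift-𝟘 zero n = refl
  shift-𝟘 (suc a) zero = refl
  shift-𝟘 (suc a) (suc n) = shift-𝟘 a n

  shift-shift : ∀ a b F → shift a (shift b F) ≗ shift (a ℕ.+ b) F
  shift-shift zero b F n = refl
  shift-shift (suc a) b F zero = refl
  shift-shift (suc a) b F (suc n) = shift-shift a b F n

  shift-comm : ∀ a b F → shift a (shift b F) ≗ shift b (shift a F)
  shift-comm a b F n = begin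
    shift a (shift b F) n  ≡⟨ shift-shift a b F n ⟩
    shift (a ℕ.+ b) F n    ≡⟨ cong (λ c → shift c F n) (ℕₚ.+-comm a b) ⟩
    shift (b ℕ.+ a) F n    ≡⟨ shift-shift b a F n ⟨
    shift b (shift a F) n  ∎

  shift-nonneg : ∀ a {F} → (∀ n → + 0 ≤ F n) → ∀ n → + 0 ≤ shift a F n
  shift-nonneg zero F≥0 n = F≥0 n
  shift-nonneg (suc a) F≥0 zero = +≤+ ℕ.z≤n
  shift-nonneg (suc a) F≥0 (suc n) = shift-nonneg a F≥0 n

  ⊕-cong : ∀ {F F′ G G′} → F ≗ F′ → G ≗ G′ → F ⊕ G ≗ F′ ⊕ G′
  ⊕-cong p q n = cong₂ _+_ (p n) (q n)

  ⊖-cong : ∀ {F F′ G G′} → F ≗ F′ → G ≗ G′ → F ⊖ G ≗ F′ ⊖ G′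
  ⊖-cong p q n = cong₂ _-_ (p n) (q n)

  module _ (m : ℕ) (F : Series) where

    private
      G = geometricPartialSum m F

    shift-geometricPartialSum : ∀ K n → shift (suc m) (G K) n ≡ G (suc K) n - F n
    shift-geometricPartialSum zero n = begin
      shift (suc m) 𝟘 n    ≡⟨ shift-𝟘 (suc m) n ⟩
      + 0                  ≡⟨ +-inverseʳ (F n) ⟨
      F n - F n            ≡⟨ cong (_- F n) (+-identityˡ (F n)) ⟨
      (+ 0 + F n) - F n    ∎
    shift-geometricPartialSum (suc K) n = begin
      shift (suc m) (G (suc K)) n
        ≡⟨ shift-⊕ (suc m) (G K) (shift (K ℕ.* suc m) F) n ⟩
      shift (suc m) (G K) n + shift (suc m) (shift (K ℕ.* suc m) F) n
        ≡⟨ cong₂ _+_ (shift-geometricPartialSum K n) (shift-shift (suc m) (K ℕ.* suc m) F n) ⟩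
      (G (suc K) n - F n) + shift (suc K ℕ.* suc m) F n
        ≡⟨ [a-b]+c≡[a+c]-b (G (suc K) n) (F n) (shift (suc K ℕ.* suc m) F n) ⟩
      G (suc (suc K)) n - F n
        ∎
      where
        [a-b]+c≡[a+c]-b : ∀ a b c → (a - b) + c ≡ (a + c) - b
        [a-b]+c≡[a+c]-b = solve-∀

    geometricPartialSum-stable : ∀ d K n → n < K → G (d ℕ.+ K) n ≡ G K n
    geometricPartialSum-stable zero K n n<K = refl
    geometricPartialSum-stable (suc d) K n n<K = begin
      G (d ℕ.+ K) n + shift ((d ℕ.+ K) ℕ.* suc m) F n
        ≡⟨ cong (λ z → G (d ℕ.+ K) n + z) (shift-< _ n F n<dK*m) ⟩
      G (d ℕ.+ K) n + + 0
        ≡⟨ +-identityʳ _ ⟩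
      G (d ℕ.+ K) n
        ≡⟨ geometricPartialSum-stable d K n n<K ⟩
      G K n
        ∎
      where
        n<dK*m : n < (d ℕ.+ K) ℕ.* suc m
        n<dK*m = ℕₚ.<-≤-trans n<K (ℕₚ.≤-trans (ℕₚ.m≤n+m K d) (ℕₚ.m≤m*n (d ℕ.+ K) (suc m)))

    mulFactor-divFactor : mulFactor m (divFactor m F) ≗ F
    mulFactor-divFactor n = begin
      G (suc n) n - shift (suc m) (divFactor m F) n
        ≡⟨ cong (G (suc n) n -_) (shift-ext (suc m) n stable) ⟩
      G (suc n) n - shift (suc m) (G (suc n)) n
        ≡⟨ cong (G (suc n) n -_) (shift-geometricPartialSum (suc n) n) ⟩
      G (suc n) n - ((G (suc n) n + shift (suc n ℕ.* suc m) F n) - F n)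
        ≡⟨ cong (λ z → G (suc n) n - ((G (suc n) n + z) - F n)) (shift-< _ n F n<) ⟩
      G (suc n) n - ((G (suc n) n + + 0) - F n)
        ≡⟨ a-[[a+0]-b]≡b (G (suc n) n) (F n) ⟩
      F n
        ∎
      where
        a-[[a+0]-b]≡b : ∀ a b → a - ((a + + 0) - b) ≡ b
        a-[[a+0]-b]≡b = solve-∀
        n< : n < suc n ℕ.* suc m
        n< = ℕₚ.<-≤-trans (ℕₚ.n<1+n n) (ℕₚ.m≤m*n (suc n) (suc m))
        stable : ∀ x → n ≡ suc m ℕ.+ x → G (suc x) x ≡ G (suc n) x
        stable x refl = begin
          G (suc x) x              ≡⟨ geometricPartialSum-stable (suc m) (suc x) x ℕₚ.≤-refl ⟨
          G (suc m ℕ.+ suc x) x    ≡⟨ cong (λ K → G K x) (ℕₚ.+-suc (suc m) x) ⟩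
          G (suc n) x              ∎

  mulFactor-injective : ∀ m {X Y} → mulFactor m X ≗ mulFactor m Y → X ≗ Y
  mulFactor-injective m {X} {Y} eq = <-rec (λ n → X n ≡ Y n) step
    where
      recover : ∀ F n → F n ≡ mulFactor m F n + shift (suc m) F n
      recover F n = a≡[a-b]+b (F n) (shift (suc m) F n)
        where
          a≡[a-b]+b : ∀ a b → a ≡ (a - b) + b
          a≡[a-b]+b = solve-∀
      step : ∀ n → (∀ {x} → x < n → X x ≡ Y x) → X n ≡ Y n
      step n ih = begin
        X n                                    ≡⟨ recover X n ⟩
        mulFactor m X n + shift (suc m) X n    ≡⟨ cong₂ _+_ (eq n) (shift-ext (suc m) n below) ⟩
        mulFactor m Y n + shift (suc m) Y n    ≡⟨ recover Y n ⟨
        Y n                                    ∎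
        where
          below : ∀ x → n ≡ suc m ℕ.+ x → X x ≡ Y x
          below x refl = ih (s≤s (ℕₚ.m≤n+m x m))

  mulFactor-cong : ∀ m {F G} → F ≗ G → mulFactor m F ≗ mulFactor m G
  mulFactor-cong m eq = ⊖-cong eq (shift-cong (suc m) eq)

  mulFactor-⊕ : ∀ m F G → mulFactor m (F ⊕ G) ≗ mulFactor m F ⊕ mulFactor m G
  mulFactor-⊕ m F G n = begin
    (F n + G n) - shift (suc m) (F ⊕ G) n
      ≡⟨ cong ((F n + G n) -_) (shift-⊕ (suc m) F G n) ⟩
    (F n + G n) - (shift (suc m) F n + shift (suc m) G n)
      ≡⟨ interchange (F n) (G n) _ _ ⟩
    (F n - shift (suc m) F n) + (G n - shift (suc m) G n)
      ∎
    where
      interchange : ∀ a b c d → (a + b) - (c + d) ≡ (a - c) + (b - d)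
      interchange = solve-∀

  mulFactor-shift : ∀ m a F → mulFactor m (shift a F) ≗ shift a (mulFactor m F)
  mulFactor-shift m a F n = begin
    shift a F n - shift (suc m) (shift a F) n  ≡⟨ cong (shift a F n -_) (shift-comm (suc m) a F n) ⟩
    shift a F n - shift a (shift (suc m) F) n  ≡⟨ shift-⊖ a F (shift (suc m) F) n ⟨
    shift a (mulFactor m F) n                  ∎

  mulFactor-comm : ∀ m m′ F → mulFactor m (mulFactor m′ F) ≗ mulFactor m′ (mulFactor m F)
  mulFactor-comm m m′ F n = begin
    (F n - B n) - shift (suc m) (F ⊖ shift (suc m′) F) n
      ≡⟨ cong ((F n - B n) -_) (shift-⊖ (suc m) F (shift (suc m′) F) n) ⟩
    (F n - B n) - (A n - shift (suc m) (shift (suc m′) F) n)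
      ≡⟨ cong (λ z → (F n - B n) - (A n - z)) (shift-comm (suc m) (suc m′) F n) ⟩
    (F n - B n) - (A n - shift (suc m′) A n)
      ≡⟨ swap-middle (F n) (B n) (A n) _ ⟩
    (F n - A n) - (B n - shift (suc m′) A n)
      ≡⟨ cong ((F n - A n) -_) (shift-⊖ (suc m′) F A n) ⟨
    (F n - A n) - shift (suc m′) (F ⊖ A) n
      ∎
    where
      A = shift (suc m) F
      B = shift (suc m′) F
      swap-middle : ∀ a b c d → (a - b) - (c - d) ≡ (a - c) - (b - d)
      swap-middle = solve-∀

  divFactor-unique : ∀ m {F G} → mulFactor m G ≗ F → divFactor m F ≗ G
  divFactor-unique m {F} eq = mulFactor-injective m (≗-trans (mulFactor-divFactor m F) (≗-sym eq))

  divFactor-cong : ∀ m {F G} → F ≗ G → divFactor m F ≗ divFactor m G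
  divFactor-cong m {F} {G} eq = divFactor-unique m (≗-trans (mulFactor-divFactor m G) (≗-sym eq))

  divFactor-⊕ : ∀ m F G → divFactor m (F ⊕ G) ≗ divFactor m F ⊕ divFactor m G
  divFactor-⊕ m F G = divFactor-unique m
    (≗-trans (mulFactor-⊕ m (divFactor m F) (divFactor m G)) (⊕-cong (mulFactor-divFactor m F) (mulFactor-divFactor m G)))

  divFactor-shift : ∀ m a F → divFactor m (shift a F) ≗ shift a (divFactor m F)
  divFactor-shift m a F = divFactor-unique m
    (≗-trans (mulFactor-shift m a (divFactor m F)) (shift-cong a (mulFactor-divFactor m F)))

  mulFactor-divFactor-comm : ∀ m m′ F → mulFactor m (divFactor m′ F) ≗ divFactor m′ (mulFactor m F)
  mulFactor-divFactor-comm m m′ F = ≗-sym (divFactor-unique m′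
    (≗-trans (mulFactor-comm m′ m (divFactor m′ F)) (mulFactor-cong m (mulFactor-divFactor m′ F))))

  divFactor-comm : ∀ m m′ F → divFactor m (divFactor m′ F) ≗ divFactor m′ (divFactor m F)
  divFactor-comm m m′ F = divFactor-unique m
    (≗-trans (mulFactor-divFactor-comm m m′ (divFactor m F)) (divFactor-cong m′ (mulFactor-divFactor m F)))

  divFactor-unfold : ∀ m F → divFactor m F ≗ F ⊕ shift (suc m) (divFactor m F)
  divFactor-unfold m F n = begin
    G n                                 ≡⟨ a≡[a-b]+b (G n) (shift (suc m) G n) ⟩
    mulFactor m G n + shift (suc m) G n ≡⟨ cong (_+ shift (suc m) G n) (mulFactor-divFactor m F n) ⟩
    F n + shift (suc m) G n             ∎
    where
      G = divFactor m F
      a≡[a-b]+b : ∀ a b → a ≡ (a - b) + b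
      a≡[a-b]+b = solve-∀

  divFactor-nonneg : ∀ m {F} → (∀ n → + 0 ≤ F n) → ∀ n → + 0 ≤ divFactor m F n
  divFactor-nonneg m {F} F≥0 n = partial≥0 (suc n)
    where
      partial≥0 : ∀ K → + 0 ≤ geometricPartialSum m F K n
      partial≥0 zero = +≤+ ℕ.z≤n
      partial≥0 (suc K) = +-mono-≤ (partial≥0 K) (shift-nonneg (K ℕ.* suc m) F≥0 n)

  -- With Z = X / ((1 - q^(i+1)) (1 - q^(i+2))):
  -- q^(i+1) Z (1 - q^(i+2)) + Z (1 - q^(i+1)) = Z (1 - q^(2i+3)).
  divFactor-pair : ∀ i X →
    shift (suc i) (divFactor i X) ⊕ divFactor (suc i) X ≗
    divFactor (suc i) (divFactor i X) ⊖ shift (suc i ℕ.+ suc (suc i)) (divFactor (suc i) (divFactor i X))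
  divFactor-pair i X n = begin
    shift L (divFactor i X) n + divFactor L X n
      ≡⟨ cong₂ _+_ (shift-cong L (≗-sym (mulFactor-divFactor L (divFactor i X))) n) (sym (mulFactor-Z n)) ⟩
    shift L (Z ⊖ shift (suc L) Z) n + (Z n - shift L Z n)
      ≡⟨ cong (_+ (Z n - shift L Z n)) (trans (shift-⊖ L Z (shift (suc L) Z) n)
                                              (cong (λ z → shift L Z n - z) (shift-shift L (suc L) Z n))) ⟩
    (shift L Z n - shift (L ℕ.+ suc L) Z n) + (Z n - shift L Z n)
      ≡⟨ telescope (shift L Z n) _ (Z n) ⟩
    Z n - shift (L ℕ.+ suc L) Z n
      ∎
    where
      L = suc i
      Z = divFactor L (divFactor i X)
      mulFactor-Z : mulFactor i Z ≗ divFactor L X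
      mulFactor-Z = ≗-trans (mulFactor-divFactor-comm i L (divFactor i X)) (divFactor-cong L (mulFactor-divFactor i X))
      telescope : ∀ x y z → (x - y) + (z - x) ≡ z - y
      telescope = solve-∀

  -- division by (q; q)_j
  divPoch : ℕ → Series → Series
  divPoch zero F = F
  divPoch (suc j) F = divFactor j (divPoch j F)

  divPoch-cong : ∀ j {F G} → F ≗ G → divPoch j F ≗ divPoch j G
  divPoch-cong zero eq = eq
  divPoch-cong (suc j) eq = divFactor-cong j (divPoch-cong j eq)

  divPoch-divFactor : ∀ j t F → divPoch j (divFactor t F) ≗ divFactor t (divPoch j F)
  divPoch-divFactor zero t F n = refl
  divPoch-divFactor (suc j) t F =
    ≗-trans (divFactor-cong j (divPoch-divFactor j t F)) (divFactor-comm j t (divPoch j F))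

  divPoch-nonneg : ∀ j {F} → (∀ n → + 0 ≤ F n) → ∀ n → + 0 ≤ divPoch j F n
  divPoch-nonneg zero F≥0 = F≥0
  divPoch-nonneg (suc j) F≥0 = divFactor-nonneg j (divPoch-nonneg j F≥0)

module PentagonalNumbers where

  open import Data.Nat using (ℕ; zero; suc; _+_; _*_; _≤_)
  import Data.Nat.Properties as ℕₚ
  open import Data.Nat.Tactic.RingSolver using (solve-∀)
  open import Relation.Binary.PropositionalEquality
  open ≡-Reasoning

  -- stairExp s j = s + (s + 1) + ⋯ + (s + j - 1) = s j + j (j - 1) / 2
  stairExp : ℕ → ℕ → ℕ
  stairExp s zero = 0
  stairExp s (suc j) = stairExp s j + s + j

  -- the pentagonal numbers (i+1)(3i+4)/2 of -(i+1) and (i+2)(3i+5)/2 of i+2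
  pent⁻ pent⁺ : ℕ → ℕ
  pent⁻ i = suc (suc i) + stairExp (3 + i) i
  pent⁺ i = pent⁻ i + (suc i + suc (suc i))

  stairExp-suc : ∀ s j → stairExp (suc s) j ≡ stairExp s j + j
  stairExp-suc s zero = refl
  stairExp-suc s (suc j) rewrite stairExp-suc s j = rearrange (stairExp s j) s j
    where
      rearrange : ∀ e s j → e + j + suc s + j ≡ e + s + j + suc j
      rearrange = solve-∀

  stairExp-peel : ∀ t i → stairExp (suc t) (suc i) ≡ suc t + stairExp (suc (suc t)) i
  stairExp-peel t i = trans (rearrange (stairExp (suc t) i) t i) (cong (suc t +_) (sym (stairExp-suc (suc t) i)))
    where
      rearrange : ∀ e t i → e + suc t + i ≡ suc t + (e + i)
      rearrange = solve-∀

  stairExp-pent⁻ : ∀ i → stairExp (3 + i) (suc i) ≡ pent⁻ i + suc i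
  stairExp-pent⁻ i = rearrange (stairExp (3 + i) i) i
    where
      rearrange : ∀ e i → e + suc (suc (suc i)) + i ≡ suc (suc i) + e + suc i
      rearrange = solve-∀

  ≤-stairExp-suc : ∀ s j → s ≤ stairExp s (suc j)
  ≤-stairExp-suc s j = ℕₚ.≤-trans (ℕₚ.m≤n+m s (stairExp s j)) (ℕₚ.m≤m+n _ j)

  stairExp-double : ∀ s j → 2 * stairExp s j + j ≡ 2 * s * j + j * j
  stairExp-double s zero = sym (cong (_+ 0) (ℕₚ.*-zeroʳ (2 * s)))
  stairExp-double s (suc j) = begin
    2 * (stairExp s j + s + j) + suc j            ≡⟨ regroup (stairExp s j) s j ⟩
    (2 * stairExp s j + j) + (2 * s + 2 * j + 1)  ≡⟨ cong (_+ (2 * s + 2 * j + 1)) (stairExp-double s j) ⟩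
    (2 * s * j + j * j) + (2 * s + 2 * j + 1)     ≡⟨ square-step s j ⟩
    2 * s * suc j + suc j * suc j                 ∎
    where
      regroup : ∀ e s j → 2 * (e + s + j) + suc j ≡ (2 * e + j) + (2 * s + 2 * j + 1)
      regroup = solve-∀
      square-step : ∀ s j → (2 * s * j + j * j) + (2 * s + 2 * j + 1) ≡ 2 * s * suc j + suc j * suc j
      square-step = solve-∀

  pent⁻-double : ∀ i → 2 * pent⁻ i ≡ suc i * (3 * suc i + 1)
  pent⁻-double i = ℕₚ.+-cancelʳ-≡ i _ _ (begin
    2 * (suc (suc i) + e) + i                    ≡⟨ regroup i e ⟩
    2 * suc (suc i) + (2 * e + i)                ≡⟨ cong (2 * suc (suc i) +_) (stairExp-double (3 + i) i) ⟩
    2 * suc (suc i) + (2 * (3 + i) * i + i * i)  ≡⟨ closed-form i ⟩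
    suc i * (3 * suc i + 1) + i                  ∎)
    where
      e = stairExp (3 + i) i
      regroup : ∀ i e → 2 * (suc (suc i) + e) + i ≡ 2 * suc (suc i) + (2 * e + i)
      regroup = solve-∀
      closed-form : ∀ i → 2 * suc (suc i) + (2 * (3 + i) * i + i * i) ≡ suc i * (3 * suc i + 1) + i
      closed-form = solve-∀

  pent⁺-double : ∀ i → 2 * pent⁺ i ≡ suc i * (3 * suc i + 1) + (4 * suc i + 2)
  pent⁺-double i = trans (distribute (pent⁻ i) i) (cong (_+ (4 * suc i + 2)) (pent⁻-double i))
    where
      distribute : ∀ a i → 2 * (a + (suc i + suc (suc i))) ≡ 2 * a + (4 * suc i + 2)
      distribute = solve-∀

module PartitionEnumeration where

  open import Defs
  open import Data.Nat using (ℕ; zero; suc; _≤_; _≥_; s≤s; z≤n)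
  import Data.Nat.Properties as ℕₚ
  open import Data.List using (List; []; _∷_; map; upTo; length)
  open import Data.List.Properties using (∷-injectiveʳ)
  open import Data.Nat.ListAction using (sum)
  open import Data.List.Relation.Unary.Linked using (Linked)
  open import Data.List.Relation.Unary.All as All using (All; []; _∷_)
  import Data.List.Relation.Unary.All.Properties as All
  open import Data.List.Relation.Unary.Any using (here; there)
  open import Data.List.Relation.Unary.AllPairs as AllPairs using ([]; _∷_)
  import Data.List.Relation.Unary.AllPairs.Properties as AllPairs
  open import Data.List.Relation.Unary.Unique.Propositional using (Unique)
  import Data.List.Relation.Unary.Unique.Propositional.Properties as Unique
  open import Data.List.Relation.Binary.Disjoint.Propositional using (Disjoint)
  open import Data.List.Membership.Propositional using (_∈_; lose; find)
  open import Data.List.Membership.Propositional.Properties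
  open import Data.Product using (_,_; _×_)
  open import Relation.Binary.PropositionalEquality

  private
    variable
      xs : List ℕ
      vs : List ℕ

  ∈-listsOfLength⁻ : ∀ m → xs ∈ listsOfLength vs m → length xs ≡ m × All (_∈ vs) xs
  ∈-listsOfLength⁻ zero (here refl) = refl , []
  ∈-listsOfLength⁻ {vs = vs} (suc m) xs∈
    with x , x∈vs , xs∈′ ← find (∈-concatMap⁻ (λ x → map (x ∷_) (listsOfLength vs m)) {xs = vs} xs∈)
    with ys , ys∈ , refl ← ∈-map⁻ (x ∷_) xs∈′
    with |ys|≡m , ys⊆vs ← ∈-listsOfLength⁻ m ys∈
    = cong suc |ys|≡m , x∈vs ∷ ys⊆vs

  ∈-listsOfLength⁺ : All (_∈ vs) xs → xs ∈ listsOfLength vs (length xs)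
  ∈-listsOfLength⁺ [] = here refl
  ∈-listsOfLength⁺ {vs = vs} {x ∷ xs} (x∈vs ∷ xs⊆vs) =
    ∈-concatMap⁺ (λ y → map (y ∷_) (listsOfLength vs (length xs)))
      (lose x∈vs (∈-map⁺ (x ∷_) (∈-listsOfLength⁺ xs⊆vs)))

  listsOfLength-unique : ∀ m → Unique vs → Unique (listsOfLength vs m)
  listsOfLength-unique zero _ = [] ∷ []
  listsOfLength-unique {vs = vs} (suc m) vs! =
    Unique.concat⁺ (All.map⁺ (All.tabulate (λ _ → Unique.map⁺ ∷-injectiveʳ (listsOfLength-unique m vs!))))
                   (AllPairs.map⁺ (AllPairs.map heads-differ vs!))
    where
      heads-differ : ∀ {x y} → x ≢ y → Disjoint (map (x ∷_) (listsOfLength vs m)) (map (y ∷_) (listsOfLength vs m))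
      heads-differ x≢y (p , q) with ∈-map⁻ _ p | ∈-map⁻ _ q
      ... | _ , _ , refl | _ , _ , refl = x≢y refl

  candidates-unique : ∀ n → Unique (candidates n)
  candidates-unique n =
    Unique.concat⁺ {xss = map (listsOfLength L) (upTo (suc n))}
      (All.map⁺ (All.tabulate {xs = upTo (suc n)} (λ {m} _ → listsOfLength-unique m L!)))
      (AllPairs.map⁺ (AllPairs.map lengths-differ (Unique.upTo⁺ (suc n))))
    where
      L = map suc (upTo n)
      L! : Unique L
      L! = Unique.map⁺ ℕₚ.suc-injective (Unique.upTo⁺ n)
      lengths-differ : ∀ {a b} → a ≢ b → Disjoint (listsOfLength L a) (listsOfLength L b)
      lengths-differ a≢b (p , q) with (|xs|≡a , _) ← ∈-listsOfLength⁻ _ p | (|xs|≡b , _) ← ∈-listsOfLength⁻ _ q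
        = a≢b (trans (sym |xs|≡a) |xs|≡b)

  partitions-unique : ∀ n → Unique (partitions n)
  partitions-unique n = Unique.filter⁺ (isPartition? n) (candidates-unique n)

  Positive : List ℕ → Set
  Positive = All (1 ≤_)

  ∈-partitions⁻ : ∀ {n λ′} → λ′ ∈ partitions n → Linked _≥_ λ′ × sum λ′ ≡ n × Positive λ′
  ∈-partitions⁻ {n} λ′∈
    with candidate , (sorted , sum≡n) ← ∈-filter⁻ (isPartition? n) {xs = candidates n} λ′∈
    with m , _ , λ′∈lists ← find (∈-concatMap⁻ (listsOfLength (map suc (upTo n))) {xs = upTo (suc n)} candidate)
    with _ , λ′⊆ ← ∈-listsOfLength⁻ m λ′∈lists
    = sorted , sum≡n , All.map positive λ′⊆
    where
      positive : ∀ {x} → x ∈ map suc (upTo n) → 1 ≤ x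
      positive x∈ with _ , _ , refl ← ∈-map⁻ suc x∈ = s≤s z≤n

  length≤sum : Positive xs → length xs ≤ sum xs
  length≤sum [] = z≤n
  length≤sum (p ∷ ps) = ℕₚ.+-mono-≤ p (length≤sum ps)

  ∈⇒≤sum : ∀ {x} → x ∈ xs → x ≤ sum xs
  ∈⇒≤sum {y ∷ ys} (here refl) = ℕₚ.m≤m+n y (sum ys)
  ∈⇒≤sum {y ∷ ys} (there x∈) = ℕₚ.≤-trans (∈⇒≤sum x∈) (ℕₚ.m≤n+m (sum ys) y)

  ∈-partitions⁺ : ∀ {n λ′} → Linked _≥_ λ′ → sum λ′ ≡ n → Positive λ′ → λ′ ∈ partitions n
  ∈-partitions⁺ {n} {λ′} sorted refl positive =
    ∈-filter⁺ (isPartition? n) {xs = candidates n} candidate (sorted , refl)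
    where
      parts-bounded : All (_∈ map suc (upTo n)) λ′
      parts-bounded = All.tabulate λ {x} x∈ → bounded x x∈ (All.lookup positive x∈)
        where
          bounded : ∀ x → x ∈ λ′ → 1 ≤ x → x ∈ map suc (upTo n)
          bounded (suc w) x∈ _ = ∈-map⁺ suc (∈-upTo⁺ (∈⇒≤sum x∈))
      candidate : λ′ ∈ candidates n
      candidate = ∈-concatMap⁺ (listsOfLength (map suc (upTo n)))
                    (lose (∈-upTo⁺ (s≤s (length≤sum positive))) (∈-listsOfLength⁺ parts-bounded))

module PartInsertion where

  open import Defs
  open import Data.Nat using (ℕ; zero; suc; _≤_; _≥_; s≤s; z≤n; _≤?_; _+_; _*_)
  import Data.Nat.Properties as ℕₚ
  open import Data.Nat.Properties using (_≟_)
  open import Algebra.Properties.CommutativeSemigroup ℕₚ.+-commutativeSemigroup using (x∙yz≈y∙xz)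
  open import Data.List using (List; []; _∷_)
  open import Data.Nat.ListAction using (sum)
  open import Data.List.Relation.Unary.Linked as Linked using (Linked; []; [-]; _∷_)
  open import Data.List.Relation.Unary.All using (All; []; _∷_)
  open import Data.Bool using (if_then_else_)
  open import Data.Empty using (⊥-elim)
  open import Relation.Nullary using (yes; no)
  open import Relation.Nullary.Decidable using (dec-true; dec-false)
  open import Relation.Binary.PropositionalEquality

  count-≡ : ∀ v {x} xs → v ≡ x → count v (x ∷ xs) ≡ suc (count v xs)
  count-≡ v {x} xs v≡x = cong (if_then suc (count v xs) else count v xs) (dec-true (v ≟ x) v≡x)

  count-≢ : ∀ v {x} xs → v ≢ x → count v (x ∷ xs) ≡ count v xs
  count-≢ v {x} xs v≢x = cong (if_then suc (count v xs) else count v xs) (dec-false (v ≟ x) v≢x)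

  insert : ℕ → List ℕ → List ℕ
  insert v [] = v ∷ []
  insert v (x ∷ xs) with x ≤? v
  ... | yes _ = v ∷ x ∷ xs
  ... | no _ = x ∷ insert v xs

  remove : ℕ → List ℕ → List ℕ
  remove v [] = []
  remove v (x ∷ xs) with v ≟ x
  ... | yes _ = xs
  ... | no _ = x ∷ remove v xs

  count-insert : ∀ v xs → count v (insert v xs) ≡ suc (count v xs)
  count-insert v [] = count-≡ v [] refl
  count-insert v (x ∷ xs) with x ≤? v
  ... | yes _ = count-≡ v (x ∷ xs) refl
  ... | no _ with v ≟ x
  ...   | yes v≡x = trans (count-≡ v (insert v xs) v≡x) (cong suc (trans (count-insert v xs) (sym (count-≡ v xs v≡x))))
  ...   | no v≢x = trans (count-≢ v (insert v xs) v≢x) (trans (count-insert v xs) (cong suc (sym (count-≢ v xs v≢x))))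

  sum-insert : ∀ v xs → sum (insert v xs) ≡ v + sum xs
  sum-insert v [] = refl
  sum-insert v (x ∷ xs) with x ≤? v
  ... | yes _ = refl
  ... | no _ = trans (cong (x +_) (sum-insert v xs)) (x∙yz≈y∙xz x v (sum xs))

  All-insert : ∀ {P : ℕ → Set} {v} xs → P v → All P xs → All P (insert v xs)
  All-insert [] pv [] = pv ∷ []
  All-insert {v = v} (x ∷ xs) pv (px ∷ pxs) with x ≤? v
  ... | yes _ = pv ∷ px ∷ pxs
  ... | no _ = px ∷ All-insert xs pv pxs

  insert-sorted : ∀ v xs → Linked _≥_ xs → Linked _≥_ (insert v xs)
  insert-sorted v [] _ = [-]
  insert-sorted v (x ∷ xs) sorted with x ≤? v
  ... | yes x≤v = x≤v ∷ sorted
  ... | no x≰v = below-head x xs sorted (ℕₚ.<⇒≤ (ℕₚ.≰⇒> x≰v))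
    where
      below-head : ∀ x xs → Linked _≥_ (x ∷ xs) → v ≤ x → Linked _≥_ (x ∷ insert v xs)
      below-head x [] _ v≤x = v≤x ∷ [-]
      below-head x (y ∷ ys) (x≥y ∷ sorted) v≤x with y ≤? v
      ... | yes y≤v = v≤x ∷ y≤v ∷ sorted
      ... | no y≰v = x≥y ∷ below-head y ys sorted (ℕₚ.<⇒≤ (ℕₚ.≰⇒> y≰v))

  remove-insert : ∀ v xs → remove v (insert v xs) ≡ xs
  remove-insert v [] with v ≟ v
  ... | yes _ = refl
  ... | no v≢v = ⊥-elim (v≢v refl)
  remove-insert v (x ∷ xs) with x ≤? v
  ... | yes _ with v ≟ v
  ...   | yes _ = refl
  ...   | no v≢v = ⊥-elim (v≢v refl)
  remove-insert v (x ∷ xs) | no x≰v with v ≟ x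
  ...   | yes refl = ⊥-elim (x≰v ℕₚ.≤-refl)
  ...   | no _ = cong (x ∷_) (remove-insert v xs)

  count-remove : ∀ v xs → 1 ≤ count v xs → count v xs ≡ suc (count v (remove v xs))
  count-remove v (x ∷ xs) occurs with v ≟ x
  ... | yes v≡x = count-≡ v xs v≡x
  ... | no v≢x = begin
    count v (x ∷ xs)               ≡⟨ count-≢ v xs v≢x ⟩
    count v xs                     ≡⟨ count-remove v xs (subst (1 ≤_) (count-≢ v xs v≢x) occurs) ⟩
    suc (count v (remove v xs))    ≡⟨ cong suc (count-≢ v (remove v xs) v≢x) ⟨
    suc (count v (x ∷ remove v xs)) ∎
    where open ≡-Reasoning

  sum-remove : ∀ v xs → 1 ≤ count v xs → v + sum (remove v xs) ≡ sum xs
  sum-remove v (x ∷ xs) occurs with v ≟ x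
  ... | yes refl = refl
  ... | no v≢x = trans (x∙yz≈y∙xz v x (sum (remove v xs)))
                       (cong (x +_) (sum-remove v xs (subst (1 ≤_) (count-≢ v xs v≢x) occurs)))

  All-remove : ∀ {P : ℕ → Set} v xs → All P xs → All P (remove v xs)
  All-remove v [] [] = []
  All-remove v (x ∷ xs) (px ∷ pxs) with v ≟ x
  ... | yes _ = pxs
  ... | no _ = px ∷ All-remove v xs pxs

  remove-sorted : ∀ v xs → Linked _≥_ xs → Linked _≥_ (remove v xs)
  remove-sorted v [] sorted = sorted
  remove-sorted v (x ∷ xs) sorted with v ≟ x
  ... | yes _ = Linked.tail sorted
  ... | no _ = under-head x xs sorted
    where
      under-head : ∀ x xs → Linked _≥_ (x ∷ xs) → Linked _≥_ (x ∷ remove v xs)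
      under-head x [] _ = [-]
      under-head x (y ∷ ys) (x≥y ∷ sorted) with v ≟ y
      under-head x (y ∷ []) _ | yes _ = [-]
      under-head x (y ∷ z ∷ zs) (x≥y ∷ y≥z ∷ sorted) | yes _ = ℕₚ.≤-trans y≥z x≥y ∷ sorted
      ... | no _ = x≥y ∷ under-head y ys sorted

  occurs⇒≤head : ∀ v x xs → Linked _≥_ (x ∷ xs) → 1 ≤ count v xs → v ≤ x
  occurs⇒≤head v x (y ∷ ys) (x≥y ∷ sorted) occurs with v ≟ y
  ... | yes refl = x≥y
  ... | no v≢y = ℕₚ.≤-trans (occurs⇒≤head v y ys sorted (subst (1 ≤_) (count-≢ v ys v≢y) occurs)) x≥y

  insert-remove : ∀ v xs → Linked _≥_ xs → 1 ≤ count v xs → insert v (remove v xs) ≡ xs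
  insert-remove v (x ∷ xs) sorted occurs with v ≟ x
  insert-remove v (x ∷ []) _ _ | yes refl = refl
  insert-remove v (x ∷ y ∷ ys) (x≥y ∷ _) _ | yes refl with y ≤? v
  ... | yes _ = refl
  ... | no y≰v = ⊥-elim (y≰v x≥y)
  insert-remove v (x ∷ xs) sorted occurs | no v≢x with x ≤? v
  ... | yes x≤v = ⊥-elim (v≢x (ℕₚ.≤-antisym (occurs⇒≤head v x xs sorted occurs′) x≤v))
    where occurs′ = subst (1 ≤_) (count-≢ v xs v≢x) occurs
  ... | no _ = cong (x ∷_) (insert-remove v xs (Linked.tail sorted) (subst (1 ≤_) (count-≢ v xs v≢x) occurs))

  insertCopies : ℕ → ℕ → List ℕ → List ℕ
  insertCopies zero v xs = xs
  insertCopies (suc c) v xs = insert v (insertCopies c v xs)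

  removeCopies : ℕ → ℕ → List ℕ → List ℕ
  removeCopies zero v xs = xs
  removeCopies (suc c) v xs = removeCopies c v (remove v xs)

  removeCopies-insertCopies : ∀ c v xs → removeCopies c v (insertCopies c v xs) ≡ xs
  removeCopies-insertCopies zero v xs = refl
  removeCopies-insertCopies (suc c) v xs =
    trans (cong (removeCopies c v) (remove-insert v (insertCopies c v xs))) (removeCopies-insertCopies c v xs)

  count-insertCopies : ∀ c v xs → count v (insertCopies c v xs) ≡ c + count v xs
  count-insertCopies zero v xs = refl
  count-insertCopies (suc c) v xs = trans (count-insert v (insertCopies c v xs)) (cong suc (count-insertCopies c v xs))

  sum-insertCopies : ∀ c v xs → sum (insertCopies c v xs) ≡ c * v + sum xs
  sum-insertCopies zero v xs = refl
  sum-insertCopies (suc c) v xs =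
    trans (sum-insert v (insertCopies c v xs))
          (trans (cong (v +_) (sum-insertCopies c v xs)) (sym (ℕₚ.+-assoc v (c * v) (sum xs))))

  insertCopies-sorted : ∀ c v xs → Linked _≥_ xs → Linked _≥_ (insertCopies c v xs)
  insertCopies-sorted zero v xs sorted = sorted
  insertCopies-sorted (suc c) v xs sorted = insert-sorted v _ (insertCopies-sorted c v xs sorted)

  All-insertCopies : ∀ {P : ℕ → Set} c v xs → P v → All P xs → All P (insertCopies c v xs)
  All-insertCopies zero v xs pv pxs = pxs
  All-insertCopies (suc c) v xs pv pxs = All-insert _ pv (All-insertCopies c v xs pv pxs)

  private
    occurs-removed : ∀ {c} v xs → suc c ≤ count v xs → c ≤ count v (remove v xs)
    occurs-removed {c} v xs c<count =
      ℕₚ.≤-pred (subst (suc c ≤_) (count-remove v xs (ℕₚ.≤-trans (s≤s z≤n) c<count)) c<count)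

  insertCopies-removeCopies : ∀ c v xs → Linked _≥_ xs → c ≤ count v xs → insertCopies c v (removeCopies c v xs) ≡ xs
  insertCopies-removeCopies zero v xs _ _ = refl
  insertCopies-removeCopies (suc c) v xs sorted c<count =
    trans (cong (insert v) (insertCopies-removeCopies c v (remove v xs) (remove-sorted v xs sorted) (occurs-removed v xs c<count)))
          (insert-remove v xs sorted (ℕₚ.≤-trans (s≤s z≤n) c<count))

  sum-removeCopies : ∀ c v xs → c ≤ count v xs → c * v + sum (removeCopies c v xs) ≡ sum xs
  sum-removeCopies zero v xs _ = refl
  sum-removeCopies (suc c) v xs c<count = begin
    (v + c * v) + sum (removeCopies c v (remove v xs))  ≡⟨ ℕₚ.+-assoc v (c * v) _ ⟩
    v + (c * v + sum (removeCopies c v (remove v xs)))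
      ≡⟨ cong (v +_) (sum-removeCopies c v (remove v xs) (occurs-removed v xs c<count)) ⟩
    v + sum (remove v xs)                               ≡⟨ sum-remove v xs (ℕₚ.≤-trans (s≤s z≤n) c<count) ⟩
    sum xs                                              ∎
    where open ≡-Reasoning

  removeCopies-sorted : ∀ c v xs → Linked _≥_ xs → Linked _≥_ (removeCopies c v xs)
  removeCopies-sorted zero v xs sorted = sorted
  removeCopies-sorted (suc c) v xs sorted = removeCopies-sorted c v (remove v xs) (remove-sorted v xs sorted)

  All-removeCopies : ∀ {P : ℕ → Set} c v xs → All P xs → All P (removeCopies c v xs)
  All-removeCopies zero v xs pxs = pxs
  All-removeCopies (suc c) v xs pxs = All-removeCopies c v (remove v xs) (All-remove v xs pxs)

module PartitionCounting where

  open import Defs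
  open PartitionEnumeration
  open PartInsertion
  open import Data.Nat using (ℕ; suc; _≤_; _<_; _≥_; s≤s; z≤n; _≤?_; _+_; _*_; _∸_)
  import Data.Nat.Properties as ℕₚ
  open import Data.List using (List; []; _∷_; map; filter; length)
  open import Data.List.Properties using (length-map; filter-none)
  open import Data.Nat.ListAction using (sum)
  open import Data.List.Relation.Unary.All as All using (All; []; _∷_)
  open import Data.List.Relation.Unary.Unique.Propositional using (Unique)
  import Data.List.Relation.Unary.Unique.Propositional.Properties as Unique
  open import Data.List.Membership.Propositional using (_∈_)
  open import Data.List.Membership.Propositional.Properties
  open import Data.List.Membership.Propositional.Properties.WithK using (unique∧set⇒bag)
  open import Data.List.Relation.Binary.BagAndSetEquality using (∼bag⇒↭)
  open import Data.List.Relation.Binary.Permutation.Propositional.Properties using (↭-length)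
  open import Data.Product using (∃; _,_; _×_; proj₁; proj₂)
  open import Data.Sum using (_⊎_; inj₁; inj₂; [_,_]′)
  open import Function using (_∘_)
  open import Data.List.Relation.Unary.Any using (here; there)
  open import Data.Empty using (⊥-elim)
  open import Function.Bundles using (mk⇔)
  open import Relation.Nullary using (Dec; yes; no; ¬_)
  open import Relation.Nullary.Decidable using (_×-dec_)
  open import Relation.Binary.PropositionalEquality

  length-bijection : ∀ {A B : Set} {xs : List A} {ys : List B} (f : A → B) → (∀ {a b} → f a ≡ f b → a ≡ b) →
    Unique xs → Unique ys → (∀ {x} → x ∈ xs → f x ∈ ys) →
    (∀ {y} → y ∈ ys → ∃ λ x → x ∈ xs × y ≡ f x) →
    length xs ≡ length ys
  length-bijection {xs = xs} {ys} f f-injective xs! ys! to from = begin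
    length xs          ≡⟨ length-map f xs ⟨
    length (map f xs)  ≡⟨ ↭-length (∼bag⇒↭ (unique∧set⇒bag fxs! ys! (mk⇔ to′ from′))) ⟩
    length ys          ∎
    where
      open ≡-Reasoning
      fxs! = Unique.map⁺ f-injective xs!
      to′ : ∀ {z} → z ∈ map f xs → z ∈ ys
      to′ z∈ with x , x∈ , refl ← ∈-map⁻ f z∈ = to x∈
      from′ : ∀ {y} → y ∈ ys → y ∈ map f xs
      from′ y∈ with x , x∈ , refl ← from y∈ = ∈-map⁺ f x∈

  #partitions : ∀ {P : List ℕ → Set} → (∀ xs → Dec (P xs)) → ℕ → ℕ
  #partitions P? n = length (filter P? (partitions n))

  PartsAtLeast : ℕ → List ℕ → Set
  PartsAtLeast s = All (s ≤_)

  partsAtLeast? : ∀ s xs → Dec (PartsAtLeast s xs)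
  partsAtLeast? s = All.all? (s ≤?_)

  WithCopies : ℕ → ℕ → ℕ → List ℕ → Set
  WithCopies s c v xs = PartsAtLeast s xs × c ≤ count v xs

  withCopies? : ∀ s c v xs → Dec (WithCopies s c v xs)
  withCopies? s c v xs = partsAtLeast? s xs ×-dec (c ≤? count v xs)

  -- Inserting c copies of a part v ≥ s is a bijection onto the partitions
  -- with parts ≥ s containing v at least c times.
  #withCopies : ∀ s c v n → 1 ≤ v → s ≤ v → c * v ≤ n →
    #partitions (withCopies? s c v) n ≡ #partitions (partsAtLeast? s) (n ∸ c * v)
  #withCopies s c v n 1≤v s≤v cv≤n = sym (length-bijection (insertCopies c v) injective
    (Unique.filter⁺ (partsAtLeast? s) (partitions-unique (n ∸ c * v)))
    (Unique.filter⁺ (withCopies? s c v) (partitions-unique n)) to from)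
    where
      injective : ∀ {xs ys} → insertCopies c v xs ≡ insertCopies c v ys → xs ≡ ys
      injective {xs} {ys} eq = begin
        xs                                    ≡⟨ removeCopies-insertCopies c v xs ⟨
        removeCopies c v (insertCopies c v xs) ≡⟨ cong (removeCopies c v) eq ⟩
        removeCopies c v (insertCopies c v ys) ≡⟨ removeCopies-insertCopies c v ys ⟩
        ys                                    ∎
        where open ≡-Reasoning
      to : ∀ {xs} → xs ∈ filter (partsAtLeast? s) (partitions (n ∸ c * v)) →
           insertCopies c v xs ∈ filter (withCopies? s c v) (partitions n)
      to {xs} xs∈
        with xs∈partitions , xs≥s ← ∈-filter⁻ (partsAtLeast? s) {xs = partitions (n ∸ c * v)} xs∈
        with sorted , sum≡ , positive ← ∈-partitions⁻ xs∈partitions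
        = ∈-filter⁺ (withCopies? s c v) {xs = partitions n}
            (∈-partitions⁺ (insertCopies-sorted c v xs sorted) sum≡n (All-insertCopies c v xs 1≤v positive))
            (All-insertCopies c v xs s≤v xs≥s , subst (c ≤_) (sym (count-insertCopies c v xs)) (ℕₚ.m≤m+n c _))
        where
          sum≡n : sum (insertCopies c v xs) ≡ n
          sum≡n = trans (sum-insertCopies c v xs) (trans (cong (c * v +_) sum≡) (ℕₚ.m+[n∸m]≡n cv≤n))
      from : ∀ {ys} → ys ∈ filter (withCopies? s c v) (partitions n) →
             ∃ λ xs → xs ∈ filter (partsAtLeast? s) (partitions (n ∸ c * v)) × ys ≡ insertCopies c v xs
      from {ys} ys∈
        with ys∈partitions , (ys≥s , enough) ← ∈-filter⁻ (withCopies? s c v) {xs = partitions n} ys∈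
        with sorted , sum≡ , positive ← ∈-partitions⁻ ys∈partitions
        = removeCopies c v ys
        , ∈-filter⁺ (partsAtLeast? s) {xs = partitions (n ∸ c * v)}
            (∈-partitions⁺ (removeCopies-sorted c v ys sorted) sum≡n∸cv (All-removeCopies c v ys positive))
            (All-removeCopies c v ys ys≥s)
        , sym (insertCopies-removeCopies c v ys sorted enough)
        where
          sum≡n∸cv : sum (removeCopies c v ys) ≡ n ∸ c * v
          sum≡n∸cv = sym (trans (cong (_∸ c * v) (trans (sym sum≡) (sym (sum-removeCopies c v ys enough))))
                                (ℕₚ.m+n∸m≡n (c * v) _))

  #withCopies-< : ∀ s c v n → n < c * v → #partitions (withCopies? s c v) n ≡ 0
  #withCopies-< s c v n n<cv = cong length (filter-none (withCopies? s c v) (All.tabulate too-few))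
    where
      too-few : ∀ {ys} → ys ∈ partitions n → ¬ WithCopies s c v ys
      too-few {ys} ys∈ (_ , enough) with _ , sum≡ , _ ← ∈-partitions⁻ ys∈ =
        ℕₚ.<⇒≱ n<cv (subst (c * v ≤_) (trans (sum-removeCopies c v ys enough) sum≡) (ℕₚ.m≤m+n (c * v) _))

  module _ {A : Set} {P Q R : A → Set} (P? : ∀ x → Dec (P x)) (Q? : ∀ x → Dec (Q x)) (R? : ∀ x → Dec (R x)) where

    length-filter-⊎ : (∀ {x} → P x → Q x ⊎ R x) → (∀ {x} → Q x → P x) → (∀ {x} → R x → P x) →
      (∀ {x} → Q x → ¬ R x) → ∀ xs → length (filter P? xs) ≡ length (filter Q? xs) + length (filter R? xs)
    length-filter-⊎ split fromQ fromR disjoint [] = refl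
    length-filter-⊎ split fromQ fromR disjoint (x ∷ xs) with P? x | Q? x | R? x
    ... | _     | yes q | yes r = ⊥-elim (disjoint q r)
    ... | yes _ | yes _ | no _  = cong suc (length-filter-⊎ split fromQ fromR disjoint xs)
    ... | yes _ | no _  | yes _ = trans (cong suc (length-filter-⊎ split fromQ fromR disjoint xs)) (sym (ℕₚ.+-suc _ _))
    ... | yes p | no ¬q | no ¬r = ⊥-elim ([ ¬q , ¬r ]′ (split p))
    ... | no ¬p | yes q | _     = ⊥-elim (¬p (fromQ q))
    ... | no ¬p | no _  | yes r = ⊥-elim (¬p (fromR r))
    ... | no _  | no _  | no _  = length-filter-⊎ split fromQ fromR disjoint xs

  length-filter-cong-∈ : ∀ {A : Set} {P Q : A → Set} (P? : ∀ x → Dec (P x)) (Q? : ∀ x → Dec (Q x)) xs →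
    (∀ {x} → x ∈ xs → P x → Q x) → (∀ {x} → x ∈ xs → Q x → P x) →
    length (filter P? xs) ≡ length (filter Q? xs)
  length-filter-cong-∈ P? Q? [] P⇒Q Q⇒P = refl
  length-filter-cong-∈ P? Q? (x ∷ xs) P⇒Q Q⇒P with P? x | Q? x
  ... | yes _ | yes _ = cong suc (length-filter-cong-∈ P? Q? xs (P⇒Q ∘ there) (Q⇒P ∘ there))
  ... | yes p | no ¬q = ⊥-elim (¬q (P⇒Q (here refl) p))
  ... | no ¬p | yes q = ⊥-elim (¬p (Q⇒P (here refl) q))
  ... | no _  | no _  = length-filter-cong-∈ P? Q? xs (P⇒Q ∘ there) (Q⇒P ∘ there)

  #partsAtLeast : ℕ → ℕ → ℕ
  #partsAtLeast s = #partitions (partsAtLeast? s)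

  no-copies⇒partsAbove : ∀ s xs → PartsAtLeast s xs → count s xs ≡ 0 → PartsAtLeast (suc s) xs
  no-copies⇒partsAbove s [] [] _ = []
  no-copies⇒partsAbove s (x ∷ xs) (s≤x ∷ xs≥s) none with s ℕₚ.≟ x
  ... | yes s≡x = ⊥-elim (ℕₚ.1+n≢0 (trans (sym (count-≡ s xs s≡x)) none))
  ... | no s≢x = ℕₚ.≤∧≢⇒< s≤x s≢x ∷ no-copies⇒partsAbove s xs xs≥s (trans (sym (count-≢ s xs s≢x)) none)

  partsAbove⇒no-copies : ∀ s xs → PartsAtLeast (suc s) xs → count s xs ≡ 0
  partsAbove⇒no-copies s [] [] = refl
  partsAbove⇒no-copies s (x ∷ xs) (s<x ∷ xs>s) = trans (count-≢ s xs (ℕₚ.<⇒≢ s<x)) (partsAbove⇒no-copies s xs xs>s)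

  #partsAtLeast-split : ∀ s n →
    #partsAtLeast s n ≡ #partitions (withCopies? s 1 s) n + #partsAtLeast (suc s) n
  #partsAtLeast-split s n = length-filter-⊎ (partsAtLeast? s) (withCopies? s 1 s) (partsAtLeast? (suc s))
    split proj₁ (All.map ℕₚ.<⇒≤) disjoint (partitions n)
    where
      split : ∀ {xs} → PartsAtLeast s xs → WithCopies s 1 s xs ⊎ PartsAtLeast (suc s) xs
      split {xs} xs≥s with 1 ≤? count s xs
      ... | yes occurs = inj₁ (xs≥s , occurs)
      ... | no ¬occurs = inj₂ (no-copies⇒partsAbove s xs xs≥s (ℕₚ.n<1⇒n≡0 (ℕₚ.≰⇒> ¬occurs)))
      disjoint : ∀ {xs} → WithCopies s 1 s xs → ¬ PartsAtLeast (suc s) xs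
      disjoint {xs} (_ , occurs) xs>s = ℕₚ.<⇒≱ (s≤s z≤n) (subst (1 ≤_) (partsAbove⇒no-copies s xs xs>s) occurs)

  #partsAtLeast-< : ∀ s n → n < s → #partsAtLeast s n ≡ #partsAtLeast (suc s) n
  #partsAtLeast-< s n n<s = begin
    #partsAtLeast s n
      ≡⟨ #partsAtLeast-split s n ⟩
    #partitions (withCopies? s 1 s) n + #partsAtLeast (suc s) n
      ≡⟨ cong (_+ #partsAtLeast (suc s) n) (#withCopies-< s 1 s n n<1*s) ⟩
    #partsAtLeast (suc s) n
      ∎
    where
      open ≡-Reasoning
      n<1*s = subst (n <_) (sym (ℕₚ.*-identityˡ s)) n<s

  #partsAtLeast-+ : ∀ s x → 1 ≤ s →
    #partsAtLeast s (s + x) ≡ #partsAtLeast s x + #partsAtLeast (suc s) (s + x)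
  #partsAtLeast-+ s x 1≤s = begin
    #partsAtLeast s (s + x)
      ≡⟨ #partsAtLeast-split s (s + x) ⟩
    #partitions (withCopies? s 1 s) (s + x) + #partsAtLeast (suc s) (s + x)
      ≡⟨ cong (_+ #partsAtLeast (suc s) (s + x)) (#withCopies s 1 s (s + x) 1≤s ℕₚ.≤-refl 1*s≤s+x) ⟩
    #partsAtLeast s (s + x ∸ 1 * s) + #partsAtLeast (suc s) (s + x)
      ≡⟨ cong (λ m → #partsAtLeast s m + #partsAtLeast (suc s) (s + x)) s+x∸1*s≡x ⟩
    #partsAtLeast s x + #partsAtLeast (suc s) (s + x)
      ∎
    where
      open ≡-Reasoning
      1*s≤s+x = subst (_≤ s + x) (sym (ℕₚ.*-identityˡ s)) (ℕₚ.m≤m+n s x)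
      s+x∸1*s≡x = trans (cong (s + x ∸_) (ℕₚ.*-identityˡ s)) (ℕₚ.m+n∸m≡n s x)

  #partsAtLeast-small : ∀ s n → suc n < s → #partsAtLeast s (suc n) ≡ 0
  #partsAtLeast-small s n n<s = cong length (filter-none (partsAtLeast? s) (All.tabulate too-small))
    where
      too-small : ∀ {ys} → ys ∈ partitions (suc n) → ¬ PartsAtLeast s ys
      too-small {[]} ys∈ _ with () ← proj₁ (proj₂ (∈-partitions⁻ {suc n} ys∈))
      too-small {y ∷ ys} ys∈ (s≤y ∷ _) with _ , sum≡ , _ ← ∈-partitions⁻ {suc n} ys∈ =
        ℕₚ.<⇒≱ n<s (ℕₚ.≤-trans s≤y (subst (y ≤_) sum≡ (ℕₚ.m≤m+n y (sum ys))))

module FiniteSums where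

  open import Defs using (sumℤ)
  open import Data.Nat as ℕ using (ℕ; zero; suc; _<_; z≤n)
  import Data.Nat.Properties as ℕₚ
  open import Data.Integer using (ℤ; +_; _+_; _-_; _*_; _≤_; +≤+)
  open import Data.Integer.Properties
    using (+-identityˡ; +-identityʳ; +-assoc; *-zeroʳ; *-distribˡ-+; +-mono-≤; pos-+)
  open import Data.Integer.Tactic.RingSolver using (solve-∀)
  open import Data.List using (List; []; _∷_; map; _++_; upTo; filter; length)
  open import Data.List.Properties using (map-∘; upTo-∷ʳ; map-applyUpTo; map-upTo)
  open import Data.Nat.ListAction using (sum)
  open import Data.List.Membership.Propositional using (_∈_)
  open import Data.List.Membership.Propositional.Properties using (∈-upTo⁻)
  open import Data.List.Relation.Unary.Any using (here; there)
  open import Data.Bool using (if_then_else_)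
  open import Data.Empty using (⊥-elim)
  open import Function using (_∘_)
  open import Relation.Nullary using (Dec; yes; no; does)
  open import Relation.Binary.Definitions using (tri<; tri≈; tri>)
  open import Relation.Binary.PropositionalEquality
  open ≡-Reasoning

  ∑ : ∀ {A : Set} → List A → (A → ℤ) → ℤ
  ∑ xs f = sumℤ (map f xs)

  module _ {A : Set} where

    ∑-++ : ∀ xs ys (f : A → ℤ) → ∑ (xs ++ ys) f ≡ ∑ xs f + ∑ ys f
    ∑-++ [] ys f = sym (+-identityˡ _)
    ∑-++ (x ∷ xs) ys f = trans (cong (λ z → f x + z) (∑-++ xs ys f)) (sym (+-assoc (f x) _ _))

    ∑-+ : ∀ xs (f g : A → ℤ) → ∑ xs (λ x → f x + g x) ≡ ∑ xs f + ∑ xs g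
    ∑-+ [] f g = refl
    ∑-+ (x ∷ xs) f g = trans (cong (λ z → f x + g x + z) (∑-+ xs f g)) (interchange (f x) (g x) _ _)
      where
        interchange : ∀ a b c d → (a + b) + (c + d) ≡ (a + c) + (b + d)
        interchange = solve-∀

    ∑-- : ∀ xs (f g : A → ℤ) → ∑ xs (λ x → f x - g x) ≡ ∑ xs f - ∑ xs g
    ∑-- [] f g = refl
    ∑-- (x ∷ xs) f g = trans (cong (λ z → f x - g x + z) (∑-- xs f g)) (interchange (f x) (g x) _ _)
      where
        interchange : ∀ a b c d → (a - b) + (c - d) ≡ (a + c) - (b + d)
        interchange = solve-∀

    ∑-*ˡ : ∀ c xs (f : A → ℤ) → ∑ xs (λ x → c * f x) ≡ c * ∑ xs f
    ∑-*ˡ c [] f = sym (*-zeroʳ c)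
    ∑-*ˡ c (x ∷ xs) f = trans (cong (λ z → c * f x + z) (∑-*ˡ c xs f)) (sym (*-distribˡ-+ c (f x) _))

    ∑-cong : ∀ xs {f g : A → ℤ} → (∀ {x} → x ∈ xs → f x ≡ g x) → ∑ xs f ≡ ∑ xs g
    ∑-cong [] eq = refl
    ∑-cong (x ∷ xs) eq = cong₂ _+_ (eq (here refl)) (∑-cong xs (eq ∘ there))

    ∑-zero : ∀ xs {f : A → ℤ} → (∀ {x} → x ∈ xs → f x ≡ + 0) → ∑ xs f ≡ + 0
    ∑-zero [] eq = refl
    ∑-zero (x ∷ xs) eq = cong₂ _+_ (eq (here refl)) (∑-zero xs (eq ∘ there))

    ∑-nonneg : ∀ xs {f : A → ℤ} → (∀ x → + 0 ≤ f x) → + 0 ≤ ∑ xs f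
    ∑-nonneg [] f≥0 = +≤+ z≤n
    ∑-nonneg (x ∷ xs) f≥0 = +-mono-≤ (f≥0 x) (∑-nonneg xs f≥0)

    pos-sum : ∀ xs (f : A → ℕ) → + sum (map f xs) ≡ ∑ xs (λ x → + f x)
    pos-sum [] f = refl
    pos-sum (x ∷ xs) f = trans (pos-+ (f x) _) (cong (λ z → + f x + z) (pos-sum xs f))

    ∑-indicator : ∀ {P : A → Set} (P? : ∀ x → Dec (P x)) v xs →
      ∑ xs (λ x → + (if does (P? x) then v else 0)) ≡ + v * + length (filter P? xs)
    ∑-indicator P? v [] = sym (*-zeroʳ (+ v))
    ∑-indicator P? v (x ∷ xs) with P? x
    ... | yes _ = trans (cong (λ z → + v + z) (∑-indicator P? v xs)) (a+a*b≡a*[1+b] (+ v) _)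
      where
        a+a*b≡a*[1+b] : ∀ a b → a + a * b ≡ a * (+ 1 + b)
        a+a*b≡a*[1+b] = solve-∀
    ... | no _ = trans (+-identityˡ _) (∑-indicator P? v xs)

  ∑-swap : ∀ {A B : Set} xs ys (f : A → B → ℤ) →
    ∑ xs (λ x → ∑ ys (f x)) ≡ ∑ ys (λ y → ∑ xs (λ x → f x y))
  ∑-swap [] ys f = sym (∑-zero ys (λ _ → refl))
  ∑-swap (x ∷ xs) ys f = trans (cong (λ z → ∑ ys (f x) + z) (∑-swap xs ys f)) (sym (∑-+ ys (f x) _))

  ∑-map : ∀ {A B : Set} (g : A → B) xs (f : B → ℤ) → ∑ (map g xs) f ≡ ∑ xs (f ∘ g)
  ∑-map g xs f = cong sumℤ (sym (map-∘ xs))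

  ∑-upTo-head : ∀ N (f : ℕ → ℤ) → ∑ (upTo (suc N)) f ≡ f 0 + ∑ (upTo N) (f ∘ suc)
  ∑-upTo-head N f = cong (λ z → f 0 + z) (cong sumℤ (trans (map-applyUpTo suc f N) (sym (map-upTo (f ∘ suc) N))))

  ∑-upTo-suc : ∀ N (f : ℕ → ℤ) → ∑ (upTo (suc N)) f ≡ ∑ (upTo N) f + f N
  ∑-upTo-suc N f = begin
    ∑ (upTo (suc N)) f          ≡⟨ cong (λ xs → ∑ xs f) (upTo-∷ʳ N) ⟨
    ∑ (upTo N ++ N ∷ []) f      ≡⟨ ∑-++ (upTo N) (N ∷ []) f ⟩
    ∑ (upTo N) f + (f N + + 0)  ≡⟨ cong (λ z → ∑ (upTo N) f + z) (+-identityʳ (f N)) ⟩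
    ∑ (upTo N) f + f N          ∎

  ∑-upTo-extend : ∀ m d (f : ℕ → ℤ) → (∀ i → m ℕ.≤ i → f i ≡ + 0) →
    ∑ (upTo (m ℕ.+ d)) f ≡ ∑ (upTo m) f
  ∑-upTo-extend m zero f vanish = cong (λ N → ∑ (upTo N) f) (ℕₚ.+-identityʳ m)
  ∑-upTo-extend m (suc d) f vanish = begin
    ∑ (upTo (m ℕ.+ suc d)) f            ≡⟨ cong (λ N → ∑ (upTo N) f) (ℕₚ.+-suc m d) ⟩
    ∑ (upTo (suc (m ℕ.+ d))) f          ≡⟨ ∑-upTo-suc (m ℕ.+ d) f ⟩
    ∑ (upTo (m ℕ.+ d)) f + f (m ℕ.+ d)  ≡⟨ cong₂ _+_ (∑-upTo-extend m d f vanish) (vanish _ (ℕₚ.m≤m+n m d)) ⟩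
    ∑ (upTo m) f + + 0                  ≡⟨ +-identityʳ _ ⟩
    ∑ (upTo m) f                        ∎

  ∑-upTo-single : ∀ N v (f : ℕ → ℤ) → v < N → (∀ i → i ≢ v → f i ≡ + 0) → ∑ (upTo N) f ≡ f v
  ∑-upTo-single (suc N) v f v<1+N others with ℕₚ.<-cmp v N
  ... | tri< v<N _ _ = begin
    ∑ (upTo (suc N)) f  ≡⟨ ∑-upTo-suc N f ⟩
    ∑ (upTo N) f + f N  ≡⟨ cong₂ _+_ (∑-upTo-single N v f v<N others) (others N (ℕₚ.>⇒≢ v<N)) ⟩
    f v + + 0           ≡⟨ +-identityʳ (f v) ⟩
    f v                 ∎
  ... | tri≈ _ refl _ = begin
    ∑ (upTo (suc v)) f  ≡⟨ ∑-upTo-suc v f ⟩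
    ∑ (upTo v) f + f v  ≡⟨ cong (_+ f v) (∑-zero (upTo v) (λ i∈ → others _ (ℕₚ.<⇒≢ (∈-upTo⁻ i∈)))) ⟩
    + 0 + f v           ≡⟨ +-identityˡ (f v) ⟩
    f v                 ∎
  ... | tri> _ _ N<v = ⊥-elim (ℕₚ.<⇒≱ N<v (ℕₚ.≤-pred v<1+N))

open import Defs
open import Data.Nat as ℕ using (ℕ; zero; suc; _∸_; _<_; s≤s; z≤n; _≤?_; _≥?_)
import Data.Nat.Properties as ℕₚ
open import Data.Nat.Tactic.RingSolver using () renaming (solve-∀ to solveℕ-∀)
open import Data.Nat.DivMod using (m*n/n≡m)
open import Data.Nat.Divisibility using (divides; _∣?_)
open import Data.Integer as ℤ using (ℤ; +_; -[1+_]; nonNegative; _≤_; _*_; _+_; _-_; -_; _^_; _/_; +≤+)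
open import Data.Integer.Properties
  using (i-j≤i; *-monoˡ-≤-nonNeg; ≤-reflexive; *-identityˡ; +-identityˡ; +-identityʳ; *-identityʳ; *-zeroʳ;
         [+m]-[+n]≡m⊖n; ⊖-≥; ⊖-<; pos-*; +-inverseʳ; [1+m]⊖[1+n]≡m⊖n)
open import Data.Integer.DivMod using (div-pos-is-/ℕ)
open import Data.Integer.Tactic.RingSolver using (solve-∀)
open import Data.List using (List; map; upTo)
open import Data.List.Membership.Propositional using (_∈_)
open import Data.List.Membership.Propositional.Properties using (∈-map⁻)
open import Data.Product using (∃; _,_; proj₂)
open import Data.Sum using (inj₁; inj₂)
open import Data.Bool using (if_then_else_; true; false)
open import Data.Empty using (⊥-elim)
open import Relation.Nullary using (yes; no; does)
open import Relation.Binary.PropositionalEquality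
open import Relation.Binary.Definitions using (tri<; tri≈; tri>)

open PowerSeries
open PentagonalNumbers

sign : ℕ → ℤ
sign i = (- + 1) ^ i

sign-square : ∀ i → sign i * sign i ≡ + 1
sign-square zero = refl
sign-square (suc i) = trans (neg-square (sign i)) (sign-square i)
  where
    neg-square : ∀ x → (- + 1 * x) * (- + 1 * x) ≡ x * x
    neg-square = solve-∀

module TruncatedPentagonal
  (g : ℕ → Series)
  (g-nonneg : ∀ s n → + 0 ≤ g s n)
  (g-rec : ∀ t → g (suc t) ≗ divFactor t (g (suc (suc t))))
  (g-low : ∀ s n → n < s → g s n ≡ 𝟙 n)
  where

  open import Data.Integer.Properties using (+-comm; +-mono-≤)

  g₁≗divPoch : ∀ m → g 1 ≗ divPoch m (g (suc m))
  g₁≗divPoch zero n = refl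
  g₁≗divPoch (suc m) =
    ≗-trans (g₁≗divPoch m)
    (≗-trans (divPoch-cong m (g-rec m)) (divPoch-divFactor m m (g (suc (suc m)))))

  -- summand j s = q^(stairExp s j) g_s / (q; q)_j, and remainder (1 + j) s is the
  -- alternating sum of the summands i ≤ j, ending with ∓1.
  summand : ℕ → ℕ → Series
  summand j s = shift (stairExp s j) (divPoch j (g s))

  remainder : ℕ → ℕ → Series
  remainder zero s = 𝟙
  remainder (suc j) s = summand j s ⊖ remainder j s

  summand-nonneg : ∀ j s n → + 0 ≤ summand j s n
  summand-nonneg j s = shift-nonneg (stairExp s j) (divPoch-nonneg j (g-nonneg s))

  summand-rec : ∀ i t → summand (suc i) (suc t) ≗
    divFactor t (summand (suc i) (suc (suc t)) ⊕ shift (suc t) (summand i (suc (suc t))))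
  summand-rec i t = begin
    shift E (divFactor i (divPoch i (g (suc t))))
      ≈⟨ shift-cong E (divFactor-cong i (divPoch-cong i (g-rec t))) ⟩
    shift E (divFactor i (divPoch i (divFactor t G)))
      ≈⟨ shift-cong E (divFactor-cong i (divPoch-divFactor i t G)) ⟩
    shift E (divFactor i (divFactor t X))
      ≈⟨ shift-cong E (divFactor-comm i t X) ⟩
    shift E (divFactor t (divFactor i X))
      ≈⟨ divFactor-shift t E (divFactor i X) ⟨
    divFactor t (shift E (divFactor i X))
      ≈⟨ divFactor-cong t (shift-cong E (divFactor-unfold i X)) ⟩
    divFactor t (shift E (X ⊕ shift (suc i) (divFactor i X)))
      ≈⟨ divFactor-cong t (shift-⊕ E X _) ⟩
    divFactor t (shift E X ⊕ shift E (shift (suc i) (divFactor i X)))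
      ≈⟨ divFactor-cong t (λ n → +-comm (shift E X n) _) ⟩
    divFactor t (shift E (shift (suc i) (divFactor i X)) ⊕ shift E X)
      ≈⟨ divFactor-cong t (⊕-cong (≗-trans (shift-shift E (suc i) (divFactor i X)) (shift-≡ _ E+i+1))
                                  (≗-trans (shift-≡ X (stairExp-peel t i)) (≗-sym (shift-shift (suc t) _ X)))) ⟩
    divFactor t (summand (suc i) (suc (suc t)) ⊕ shift (suc t) (summand i (suc (suc t))))
      ∎
    where
      open ≗-Reasoning
      E = stairExp (suc t) (suc i)
      G = g (suc (suc t))
      X = divPoch i G
      E+i+1 : E ℕ.+ suc i ≡ stairExp (suc (suc t)) (suc i)
      E+i+1 = sym (stairExp-suc (suc t) (suc i))

  remainder-rec : ∀ j t → remainder (suc j) (suc t) ≗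
    remainder (suc j) (suc (suc t)) ⊕ shift (suc t) (divFactor t (summand j (suc (suc t))))
  remainder-rec zero t n = begin
    g (suc t) n - 𝟙 n
      ≡⟨ cong (_- 𝟙 n) (trans (g-rec t n) (divFactor-unfold t G n)) ⟩
    (G n + shift (suc t) (divFactor t G) n) - 𝟙 n
      ≡⟨ [a+b]-c≡[a-c]+b (G n) _ (𝟙 n) ⟩
    (G n - 𝟙 n) + shift (suc t) (divFactor t G) n
      ∎
    where
      open ≡-Reasoning
      G = g (suc (suc t))
      [a+b]-c≡[a-c]+b : ∀ a b c → (a + b) - c ≡ (a - c) + b
      [a+b]-c≡[a-c]+b = solve-∀
  remainder-rec (suc i) t n = begin
    summand (suc i) s n - remainder (suc i) s n
      ≡⟨ cong₂ _-_ (trans (summand-rec i t n) (divFactor-⊕ t A (shift s B) n)) (remainder-rec i t n) ⟩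
    (divFactor t A n + divFactor t (shift s B) n) - (remainder (suc i) s′ n + shift s (divFactor t B) n)
      ≡⟨ cong₂ (λ x y → (x + y) - (remainder (suc i) s′ n + shift s (divFactor t B) n))
               (divFactor-unfold t A n) (divFactor-shift t s B n) ⟩
    ((A n + shift s (divFactor t A) n) + shift s (divFactor t B) n) - (remainder (suc i) s′ n + shift s (divFactor t B) n)
      ≡⟨ cancel (A n) _ _ (remainder (suc i) s′ n) ⟩
    (A n - remainder (suc i) s′ n) + shift s (divFactor t A) n
      ∎
    where
      open ≡-Reasoning
      s = suc t
      s′ = suc (suc t)
      A = summand (suc i) s′
      B = summand i s′
      cancel : ∀ a c d y → ((a + c) + d) - (y + d) ≡ (a - y) + c
      cancel = solve-∀

  remainder-low : ∀ j s n → n < s → remainder (suc j) s n ≡ + 0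
  remainder-low zero s n n<s = trans (cong (_- 𝟙 n) (g-low s n n<s)) (+-inverseʳ (𝟙 n))
  remainder-low (suc j) s n n<s = cong₂ _-_ (shift-< _ n _ n<stairExp) (remainder-low j s n n<s)
    where
      n<stairExp : n < stairExp s (suc j)
      n<stairExp = ℕₚ.<-≤-trans n<s (≤-stairExp-suc s j)

  -- Unrolling remainder-rec from s up to s + d, where remainder-low takes over.
  remainder-nonneg : ∀ j t n → + 0 ≤ remainder (suc j) (suc t) n
  remainder-nonneg j t n = from-distance n t (ℕ.s≤s (ℕₚ.m≤n+m n t))
    where
      from-distance : ∀ d t → n < suc t ℕ.+ d → + 0 ≤ remainder (suc j) (suc t) n
      from-distance zero t n< =
        ≤-reflexive (sym (remainder-low j (suc t) n (subst (n <_) (ℕₚ.+-identityʳ (suc t)) n<)))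
      from-distance (suc d) t n< rewrite remainder-rec j t n =
        +-mono-≤ (from-distance d (suc t) (subst (n <_) (ℕₚ.+-suc (suc t) d) n<))
                 (shift-nonneg (suc t) (divFactor-nonneg t (summand-nonneg j (suc (suc t)))) n)

  remainder-pair : ∀ i →
    remainder (suc (suc i)) (suc (suc (suc i))) ⊕ remainder (suc i) (suc (suc i)) ≗
    shift (pent⁻ i) (g 1) ⊖ shift (pent⁺ i) (g 1)
  remainder-pair i = begin
    remainder (suc L) s₂ ⊕ remainder L s₁
      ≈⟨ (λ n → cong (λ z → remainder (suc L) s₂ n + z) (remainder-rec i L n)) ⟩
    (summand L s₂ ⊖ remainder L s₂) ⊕ (remainder L s₂ ⊕ shift s₁ (divFactor L (summand i s₂)))
      ≈⟨ (λ n → cancel (summand L s₂ n) (remainder L s₂ n) _) ⟩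
    summand L s₂ ⊕ shift s₁ (divFactor L (summand i s₂))
      ≈⟨ ⊕-cong first second ⟩
    shift (pent⁻ i) (shift L (divFactor i X)) ⊕ shift (pent⁻ i) (divFactor L X)
      ≈⟨ shift-⊕ (pent⁻ i) (shift L (divFactor i X)) (divFactor L X) ⟨
    shift (pent⁻ i) (shift L (divFactor i X) ⊕ divFactor L X)
      ≈⟨ shift-cong (pent⁻ i) (divFactor-pair i X) ⟩
    shift (pent⁻ i) (Z ⊖ shift B Z)
      ≈⟨ shift-cong (pent⁻ i) (⊖-cong Z≗g₁ (shift-cong B Z≗g₁)) ⟩
    shift (pent⁻ i) (g 1 ⊖ shift B (g 1))
      ≈⟨ shift-⊖ (pent⁻ i) (g 1) (shift B (g 1)) ⟩
    shift (pent⁻ i) (g 1) ⊖ shift (pent⁻ i) (shift B (g 1))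
      ≈⟨ ⊖-cong {F = shift (pent⁻ i) (g 1)} ≗-refl (shift-shift (pent⁻ i) B (g 1)) ⟩
    shift (pent⁻ i) (g 1) ⊖ shift (pent⁺ i) (g 1)
      ∎
    where
      open ≗-Reasoning
      L = suc i
      s₁ = suc L
      s₂ = suc s₁
      B = L ℕ.+ suc L
      X = divPoch i (g s₂)
      Z = divFactor L (divFactor i X)
      Z≗g₁ : Z ≗ g 1
      Z≗g₁ = ≗-sym (g₁≗divPoch (suc L))
      cancel : ∀ w y c → (w - y) + (y + c) ≡ w + c
      cancel = solve-∀
      first : summand L s₂ ≗ shift (pent⁻ i) (shift L (divFactor i X))
      first = ≗-trans (shift-≡ (divFactor i X) (stairExp-pent⁻ i)) (≗-sym (shift-shift (pent⁻ i) L (divFactor i X)))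
      second : shift s₁ (divFactor L (summand i s₂)) ≗ shift (pent⁻ i) (divFactor L X)
      second = ≗-trans (shift-cong s₁ (divFactor-shift L (stairExp s₂ i) X))
                       (shift-shift s₁ (stairExp s₂ i) (divFactor L X))

  -- the series Σ_{j = -i}^{i+1} (-1)^j q^(j(3j-1)/2) g_1
  truncatedSum : ℕ → Series
  truncatedSum zero = g 1 ⊖ shift 1 (g 1)
  truncatedSum (suc i) n = truncatedSum i n + sign (suc i) * (shift (pent⁻ i) (g 1) n - shift (pent⁺ i) (g 1) n)

  truncatedSum-remainder : ∀ i n → truncatedSum i n ≡ 𝟙 n + sign i * remainder (suc i) (suc (suc i)) n
  truncatedSum-remainder zero n = begin
    mulFactor 0 (g 1) n                   ≡⟨ mulFactor-cong 0 (g-rec 0) n ⟩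
    mulFactor 0 (divFactor 0 (g 2)) n     ≡⟨ mulFactor-divFactor 0 (g 2) n ⟩
    g 2 n                                 ≡⟨ d+1*[y-d]≡y (𝟙 n) (g 2 n) ⟨
    𝟙 n + + 1 * (g 2 n - 𝟙 n)             ∎
    where
      open ≡-Reasoning
      d+1*[y-d]≡y : ∀ d y → d + + 1 * (y - d) ≡ y
      d+1*[y-d]≡y = solve-∀
  truncatedSum-remainder (suc i) n = begin
    truncatedSum i n + sign (suc i) * (shift (pent⁻ i) (g 1) n - shift (pent⁺ i) (g 1) n)
      ≡⟨ cong₂ (λ x y → x + sign (suc i) * y) (truncatedSum-remainder i n) (sym (remainder-pair i n)) ⟩
    (𝟙 n + sign i * R n) + (- + 1 * sign i) * (R′ n + R n)
      ≡⟨ collect (𝟙 n) (sign i) (R′ n) (R n) ⟩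
    𝟙 n + sign (suc i) * R′ n
      ∎
    where
      open ≡-Reasoning
      R = remainder (suc i) (suc (suc i))
      R′ = remainder (suc (suc i)) (suc (suc (suc i)))
      collect : ∀ d s y′ y → (d + s * y) + (- + 1 * s) * (y′ + y) ≡ d + (- + 1 * s) * y′
      collect = solve-∀

  truncatedSum-sign : ∀ i n → + 0 ≤ sign i * (truncatedSum i n - 𝟙 n)
  truncatedSum-sign i n = subst (+ 0 ≤_) (sym signed) (remainder-nonneg i (suc i) n)
    where
      open ≡-Reasoning
      R = remainder (suc i) (suc (suc i)) n
      signed : sign i * (truncatedSum i n - 𝟙 n) ≡ R
      signed = begin
        sign i * (truncatedSum i n - 𝟙 n)         ≡⟨ cong (λ x → sign i * (x - 𝟙 n)) (truncatedSum-remainder i n) ⟩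
        sign i * ((𝟙 n + sign i * R) - 𝟙 n)       ≡⟨ regroup (sign i) (𝟙 n) R ⟩
        (sign i * sign i) * R                     ≡⟨ cong (_* R) (sign-square i) ⟩
        + 1 * R                                   ≡⟨ *-identityˡ R ⟩
        R                                         ∎
        where
          regroup : ∀ s d y → s * ((d + s * y) - d) ≡ (s * s) * y
          regroup = solve-∀

open PartitionEnumeration using (∈-partitions⁻)
open PartitionCounting
  using (#partitions; #partsAtLeast; withCopies?; #withCopies; #withCopies-<; length-filter-cong-∈;
         #partsAtLeast-<; #partsAtLeast-+; #partsAtLeast-small)
open FiniteSums

open ≡-Reasoning

p≥ : ℕ → Series
p≥ s n = + #partsAtLeast s n

p≥-nonneg : ∀ s n → + 0 ≤ p≥ s n
p≥-nonneg s n = +≤+ z≤n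

p≥-low : ∀ s n → n < s → p≥ s n ≡ 𝟙 n
p≥-low s zero _ = refl
p≥-low s (suc n) n<s = cong +_ (#partsAtLeast-small s n n<s)

p≥-rec : ∀ t → p≥ (suc t) ≗ divFactor t (p≥ (suc (suc t)))
p≥-rec t = ≗-sym (divFactor-unique t mulFactor-p≥)
  where
    s = suc t
    beyond : ∀ x → mulFactor t (p≥ s) (s ℕ.+ x) ≡ p≥ (suc s) (s ℕ.+ x)
    beyond x = begin
      p≥ s (s ℕ.+ x) - shift s (p≥ s) (s ℕ.+ x)
        ≡⟨ cong₂ _-_ (cong +_ (#partsAtLeast-+ s x (s≤s z≤n))) (shift-+ s x (p≥ s)) ⟩
      (p≥ s x + p≥ (suc s) (s ℕ.+ x)) - p≥ s x
        ≡⟨ [a+b]-a≡b (p≥ s x) _ ⟩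
      p≥ (suc s) (s ℕ.+ x)
        ∎
      where
        [a+b]-a≡b : ∀ a b → (a + b) - a ≡ b
        [a+b]-a≡b = solve-∀
    mulFactor-p≥ : mulFactor t (p≥ s) ≗ p≥ (suc s)
    mulFactor-p≥ n with ℕₚ.<-≤-connex n s
    ... | inj₁ n<s = begin
      p≥ s n - shift s (p≥ s) n  ≡⟨ cong (λ z → p≥ s n - z) (shift-< s n _ n<s) ⟩
      p≥ s n - + 0               ≡⟨ +-identityʳ _ ⟩
      p≥ s n                     ≡⟨ cong +_ (#partsAtLeast-< s n n<s) ⟩
      p≥ (suc s) n               ∎
    ... | inj₂ s≤n = subst (λ m → mulFactor t (p≥ s) m ≡ p≥ (suc s) m) (ℕₚ.m+[n∸m]≡n s≤n) (beyond (n ∸ s))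

open TruncatedPentagonal p≥ p≥-nonneg p≥-rec p≥-low

p : ℤ → ℤ
p (+ m) = p≥ 1 m
p -[1+ m ] = + 0

negative-difference : ∀ {m a} → m < a → ∃ λ d → + m - + a ≡ -[1+ d ]
negative-difference {m} {suc a} (s≤s m≤a) = a ∸ m , (begin
  + m - + suc a        ≡⟨ [+m]-[+n]≡m⊖n m (suc a) ⟩
  m ℤ.⊖ suc a          ≡⟨ ⊖-< (s≤s m≤a) ⟩
  - + (suc a ∸ m)      ≡⟨ cong (λ d → - + d) (ℕₚ.+-∸-assoc 1 m≤a) ⟩
  -[1+ a ∸ m ]         ∎)

p-below : ∀ {m a} → m < a → p (+ m - + a) ≡ + 0
p-below m<a with d , eq ← negative-difference m<a = cong p eq

p-above : ∀ {m a} → a ℕ.≤ m → p (+ m - + a) ≡ p≥ 1 (m ∸ a)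
p-above {m} {a} a≤m = cong p (trans ([+m]-[+n]≡m⊖n m a) (⊖-≥ a≤m))

p-negative : ∀ d a → p (-[1+ d ] - + a) ≡ + 0
p-negative d zero = refl
p-negative d (suc a) = refl

shift-p : ∀ a m → shift a (p≥ 1) m ≡ p (+ m - + a)
shift-p a m with ℕₚ.<-≤-connex m a
... | inj₁ m<a = trans (shift-< a m _ m<a) (sym (p-below m<a))
... | inj₂ a≤m = begin
  shift a (p≥ 1) m                      ≡⟨ cong (shift a (p≥ 1)) (ℕₚ.m+[n∸m]≡n a≤m) ⟨
  shift a (p≥ 1) (a ℕ.+ (m ∸ a))        ≡⟨ shift-+ a (m ∸ a) (p≥ 1) ⟩
  p≥ 1 (m ∸ a)                          ≡⟨ p-above a≤m ⟨
  p (+ m - + a)                         ∎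

truncatedSumℤ : ℕ → ℤ → ℤ
truncatedSumℤ i (+ m) = truncatedSum i m
truncatedSumℤ i -[1+ _ ] = + 0

𝟙ℤ : ℤ → ℤ
𝟙ℤ (+ m) = 𝟙 m
𝟙ℤ -[1+ _ ] = + 0

truncatedSumℤ-zero : ∀ y → truncatedSumℤ 0 y ≡ p y - p (y - + 1)
truncatedSumℤ-zero (+ m) = cong (λ z → p≥ 1 m - z) (shift-p 1 m)
truncatedSumℤ-zero -[1+ _ ] = refl

truncatedSumℤ-suc : ∀ i y → truncatedSumℤ (suc i) y ≡
  truncatedSumℤ i y + sign (suc i) * (p (y - + pent⁻ i) - p (y - + pent⁺ i))
truncatedSumℤ-suc i (+ m) =
  cong (λ z → truncatedSum i m + sign (suc i) * z) (cong₂ _-_ (shift-p (pent⁻ i) m) (shift-p (pent⁺ i) m))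
truncatedSumℤ-suc i -[1+ d ] = sym (begin
  + 0 + sign (suc i) * (p (-[1+ d ] - + pent⁻ i) - p (-[1+ d ] - + pent⁺ i))
    ≡⟨ +-identityˡ _ ⟩
  sign (suc i) * (p (-[1+ d ] - + pent⁻ i) - p (-[1+ d ] - + pent⁺ i))
    ≡⟨ cong (λ z → sign (suc i) * z) (cong₂ _-_ (p-negative d (pent⁻ i)) (p-negative d (pent⁺ i))) ⟩
  sign (suc i) * (+ 0 - + 0)
    ≡⟨ *-zeroʳ (sign (suc i)) ⟩
  + 0
    ∎)

truncatedSumℤ-sign : ∀ i y → + 0 ≤ sign i * (truncatedSumℤ i y - 𝟙ℤ y)
truncatedSumℤ-sign i (+ m) = truncatedSum-sign i m
truncatedSumℤ-sign i -[1+ _ ] = ≤-reflexive (sym (*-zeroʳ (sign i)))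

halve : ∀ m → + (2 ℕ.* m) / + 2 ≡ + m
halve m = trans (div-pos-is-/ℕ (+ (2 ℕ.* m)) 2) (cong +_ (trans (cong (ℕ._/ 2) (ℕₚ.*-comm 2 m)) (m*n/n≡m m 2)))

numerator-lift : ∀ i → + (suc i ℕ.* (3 ℕ.* suc i ℕ.+ 1)) ≡ + suc i * (+ 3 * + suc i + + 1)
numerator-lift i = trans (pos-* (suc i) _) (cong (λ z → + suc i * (z + + 1)) (pos-* 3 (suc i)))

pent-neg : ∀ i → pent -[1+ i ] ≡ + pent⁻ i
pent-neg i = begin
  (- L * (+ 3 * - L - + 1)) / + 2              ≡⟨ cong (_/ + 2) (negate L) ⟩
  (L * (+ 3 * L + + 1)) / + 2                   ≡⟨ cong (_/ + 2) (numerator-lift i) ⟨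
  + (suc i ℕ.* (3 ℕ.* suc i ℕ.+ 1)) / + 2       ≡⟨ cong (λ m → + m / + 2) (pent⁻-double i) ⟨
  + (2 ℕ.* pent⁻ i) / + 2                       ≡⟨ halve (pent⁻ i) ⟩
  + pent⁻ i                                     ∎
  where
    L = + suc i
    negate : ∀ L → - L * (+ 3 * - L - + 1) ≡ L * (+ 3 * L + + 1)
    negate = solve-∀

pent-pos : ∀ i → pent (+ suc (suc i)) ≡ + pent⁺ i
pent-pos i = begin
  ((+ 1 + L) * (+ 3 * (+ 1 + L) - + 1)) / + 2
    ≡⟨ cong (_/ + 2) (shift-by-one L) ⟩
  (L * (+ 3 * L + + 1) + (+ 4 * L + + 2)) / + 2
    ≡⟨ cong (_/ + 2) (cong₂ _+_ (numerator-lift i) (cong (_+ + 2) (pos-* 4 (suc i)))) ⟨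
  + (suc i ℕ.* (3 ℕ.* suc i ℕ.+ 1) ℕ.+ (4 ℕ.* suc i ℕ.+ 2)) / + 2
    ≡⟨ cong (λ m → + m / + 2) (pent⁺-double i) ⟨
  + (2 ℕ.* pent⁺ i) / + 2
    ≡⟨ halve (pent⁺ i) ⟩
  + pent⁺ i
    ∎
  where
    L = + suc i
    shift-by-one : ∀ L → (+ 1 + L) * (+ 3 * (+ 1 + L) - + 1) ≡ L * (+ 3 * L + + 1) + (+ 4 * L + + 2)
    shift-by-one = solve-∀

pent-nonneg : ∀ j → + 0 ≤ pent j
pent-nonneg -[1+ i ] = subst (+ 0 ≤_) (sym (pent-neg i)) (+≤+ z≤n)
pent-nonneg (+ zero) = +≤+ z≤n
pent-nonneg (+ suc zero) = +≤+ z≤n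
pent-nonneg (+ suc (suc i)) = subst (+ 0 ≤_) (sym (pent-pos i)) (+≤+ z≤n)

range-suc : ∀ i (h : ℤ → ℤ) →
  ∑ (range (suc (suc i))) h ≡ h -[1+ i ] + (∑ (range (suc i)) h + h (+ suc (suc i)))
range-suc i h = begin
  ∑ (range (suc L)) h
    ≡⟨ ∑-map (λ m → + m - + L) (upTo (2 ℕ.* suc L)) h ⟩
  ∑ (upTo (2 ℕ.* suc L)) F
    ≡⟨ cong (λ N → ∑ (upTo N) F) (ℕₚ.*-suc 2 L) ⟩
  ∑ (upTo (suc (suc (2 ℕ.* L)))) F
    ≡⟨ ∑-upTo-head (suc (2 ℕ.* L)) F ⟩
  F 0 + ∑ (upTo (suc (2 ℕ.* L))) (λ m → F (suc m))
    ≡⟨ cong (λ z → F 0 + z) (∑-upTo-suc (2 ℕ.* L) (λ m → F (suc m))) ⟩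
  F 0 + (∑ (upTo (2 ℕ.* L)) (λ m → F (suc m)) + F (suc (2 ℕ.* L)))
    ≡⟨ cong₂ (λ x y → F 0 + (x + y)) inner last ⟩
  h -[1+ i ] + (∑ (range L) h + h (+ suc L))
    ∎
  where
    L = suc i
    F = λ m → h (+ m - + L)
    inner : ∑ (upTo (2 ℕ.* L)) (λ m → F (suc m)) ≡ ∑ (range L) h
    inner = sym (trans (∑-map (λ m → + m - + i) (upTo (2 ℕ.* L)) h)
                       (∑-cong (upTo (2 ℕ.* L)) λ {m} _ → cong h (sym (suc-cancel m))))
      where
        suc-cancel : ∀ m → + suc m - + suc i ≡ + m - + i
        suc-cancel m = trans ([+m]-[+n]≡m⊖n (suc m) (suc i)) (trans ([1+m]⊖[1+n]≡m⊖n m i) (sym ([+m]-[+n]≡m⊖n m i)))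
    last : F (suc (2 ℕ.* L)) ≡ h (+ suc L)
    last = cong h (trans (cong (λ x → + x - + L) (twice L)) ([a+b]-a≡b (+ L) (+ suc L)))
      where
        twice : ∀ L → suc (2 ℕ.* L) ≡ L ℕ.+ suc L
        twice = solveℕ-∀
        [a+b]-a≡b : ∀ a b → (a + b) - a ≡ b
        [a+b]-a≡b = solve-∀

range-sum : ∀ i y → ∑ (range (suc i)) (λ j → signPow j * p (y - pent j)) ≡ truncatedSumℤ i y
range-sum zero y = begin
  + 1 * p (y - + 0) + (- + 1 * p (y - + 1) + + 0)
    ≡⟨ cong (λ x → + 1 * p x + (- + 1 * p (y - + 1) + + 0)) (+-identityʳ y) ⟩
  + 1 * p y + (- + 1 * p (y - + 1) + + 0)
    ≡⟨ collect (p y) (p (y - + 1)) ⟨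
  p y - p (y - + 1)
    ≡⟨ truncatedSumℤ-zero y ⟨
  truncatedSumℤ 0 y
    ∎
  where
    collect : ∀ a b → a - b ≡ + 1 * a + (- + 1 * b + + 0)
    collect = solve-∀
range-sum (suc i) y = begin
  ∑ (range (suc (suc i))) h
    ≡⟨ range-suc i h ⟩
  h -[1+ i ] + (∑ (range (suc i)) h + h (+ suc (suc i)))
    ≡⟨ cong₂ (λ a b → a + (b + h (+ suc (suc i)))) (cong (λ z → s * p (y - z)) (pent-neg i)) (range-sum i y) ⟩
  s * p (y - + pent⁻ i) + (truncatedSumℤ i y + h (+ suc (suc i)))
    ≡⟨ cong (λ z → s * p (y - + pent⁻ i) + (truncatedSumℤ i y + - + 1 * s * p (y - z))) (pent-pos i) ⟩
  s * p (y - + pent⁻ i) + (truncatedSumℤ i y + - + 1 * s * p (y - + pent⁺ i))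
    ≡⟨ collect s (p (y - + pent⁻ i)) (truncatedSumℤ i y) (p (y - + pent⁺ i)) ⟩
  truncatedSumℤ i y + s * (p (y - + pent⁻ i) - p (y - + pent⁺ i))
    ≡⟨ truncatedSumℤ-suc i y ⟨
  truncatedSumℤ (suc i) y
    ∎
  where
    h = λ j → signPow j * p (y - pent j)
    s = sign (suc i)
    collect : ∀ s a T b → s * a + (T + - + 1 * s * b) ≡ T + s * (a - b)
    collect = solve-∀

#atLeastCopies : ∀ k v m → 1 ℕ.≤ v → + #partitions (λ μ → count v μ ≥? k) m ≡ p (+ m - + (k ℕ.* v))
#atLeastCopies k v m 1≤v = trans (cong +_ positive-parts) copies
  where
    positive-parts : #partitions (λ μ → count v μ ≥? k) m ≡ #partitions (withCopies? 1 k v) m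
    positive-parts = length-filter-cong-∈ (λ μ → count v μ ≥? k) (withCopies? 1 k v) (partitions m)
      (λ μ∈ enough → proj₂ (proj₂ (∈-partitions⁻ {m} μ∈)) , enough) (λ _ → proj₂)
    copies : + #partitions (withCopies? 1 k v) m ≡ p (+ m - + (k ℕ.* v))
    copies with k ℕ.* v ≤? m
    ... | yes kv≤m = trans (cong +_ (#withCopies 1 k v m 1≤v 1≤v kv≤m)) (sym (p-above kv≤m))
    ... | no kv≰m = trans (cong +_ (#withCopies-< 1 k v m (ℕₚ.≰⇒> kv≰m))) (sym (p-below (ℕₚ.≰⇒> kv≰m)))

bℕ-expansion : ∀ k m → + bℕ k m ≡ ∑ (upTo m) (λ i → + suc i * p (+ m - + (k ℕ.* suc i)))
bℕ-expansion k m = begin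
  + bℕ k m
    ≡⟨ pos-sum (partitions m) (sumParts≥ k m) ⟩
  ∑ (partitions m) (λ μ → + sumParts≥ k m μ)
    ≡⟨ ∑-cong (partitions m) (λ {μ} _ → pos-sum values (indicator μ)) ⟩
  ∑ (partitions m) (λ μ → ∑ values (λ v → + indicator μ v))
    ≡⟨ ∑-swap (partitions m) values (λ μ v → + indicator μ v) ⟩
  ∑ values (λ v → ∑ (partitions m) (λ μ → + indicator μ v))
    ≡⟨ ∑-cong values (λ {v} _ → ∑-indicator (λ μ → count v μ ≥? k) v (partitions m)) ⟩
  ∑ values (λ v → + v * + #partitions (λ μ → count v μ ≥? k) m)
    ≡⟨ ∑-cong values (λ {v} v∈ → cong (λ z → + v * z) (#atLeastCopies k v m (positive v∈))) ⟩
  ∑ values (λ v → + v * p (+ m - + (k ℕ.* v)))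
    ≡⟨ ∑-map suc (upTo m) _ ⟩
  ∑ (upTo m) (λ i → + suc i * p (+ m - + (k ℕ.* suc i)))
    ∎
  where
    values = map suc (upTo m)
    indicator : List ℕ → ℕ → ℕ
    indicator μ v = if does (count v μ ≥? k) then v else 0
    positive : ∀ {v} → v ∈ values → 1 ℕ.≤ v
    positive v∈ with _ , _ , refl ← ∈-map⁻ suc v∈ = s≤s z≤n

b-expansion : ∀ k → 1 ℕ.≤ k → ∀ x N → x ≤ + N →
  b k x ≡ ∑ (upTo N) (λ i → + suc i * p (x - + (k ℕ.* suc i)))
b-expansion k 1≤k (+ m) N (+≤+ m≤N) = begin
  b k (+ m)                 ≡⟨ b-pos m ⟩
  + bℕ k m                  ≡⟨ bℕ-expansion k m ⟩
  ∑ (upTo m) T              ≡⟨ ∑-upTo-extend m (N ∸ m) T vanish ⟨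
  ∑ (upTo (m ℕ.+ (N ∸ m))) T ≡⟨ cong (λ n → ∑ (upTo n) T) (ℕₚ.m+[n∸m]≡n m≤N) ⟩
  ∑ (upTo N) T              ∎
  where
    T = λ i → + suc i * p (+ m - + (k ℕ.* suc i))
    b-pos : ∀ m → b k (+ m) ≡ + bℕ k m
    b-pos zero = refl
    b-pos (suc m) = refl
    vanish : ∀ i → m ℕ.≤ i → T i ≡ + 0
    vanish i m≤i = trans (cong (λ z → + suc i * z) (p-below m<k[i+1])) (*-zeroʳ (+ suc i))
      where
        instance _ = ℕ.>-nonZero 1≤k
        m<k[i+1] = ℕₚ.<-≤-trans (s≤s m≤i) (ℕₚ.m≤n*m (suc i) k)
b-expansion k 1≤k -[1+ d ] N _ = sym (∑-zero (upTo N) λ {i} _ →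
  trans (cong (λ z → + suc i * z) (p-negative d (k ℕ.* suc i))) (*-zeroʳ (+ suc i)))

remaining : ℕ → ℕ → ℕ → ℤ
remaining k n v = + n - + (k ℕ.* suc v)

alternating-b-sum : ∀ k i n → 1 ℕ.≤ k →
  ∑ (range (suc i)) (λ j → signPow j * b k (+ n - pent j)) ≡
  ∑ (upTo n) (λ v → + suc v * truncatedSumℤ i (remaining k n v))
alternating-b-sum k i n 1≤k = begin
  ∑ js (λ j → signPow j * b k (+ n - pent j))
    ≡⟨ ∑-cong js (λ {j} _ → expand j) ⟩
  ∑ js (λ j → ∑ vs (λ v → signPow j * (+ suc v * p ((+ n - pent j) - + (k ℕ.* suc v)))))
    ≡⟨ ∑-swap js vs _ ⟩
  ∑ vs (λ v → ∑ js (λ j → signPow j * (+ suc v * p ((+ n - pent j) - + (k ℕ.* suc v)))))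
    ≡⟨ ∑-cong vs (λ {v} _ → factor v) ⟩
  ∑ vs (λ v → + suc v * ∑ js (λ j → signPow j * p (remaining k n v - pent j)))
    ≡⟨ ∑-cong vs (λ {v} _ → cong (λ z → + suc v * z) (range-sum i (remaining k n v))) ⟩
  ∑ vs (λ v → + suc v * truncatedSumℤ i (remaining k n v))
    ∎
  where
    js = range (suc i)
    vs = upTo n
    expand : ∀ j → signPow j * b k (+ n - pent j) ≡
                   ∑ vs (λ v → signPow j * (+ suc v * p ((+ n - pent j) - + (k ℕ.* suc v))))
    expand j = trans (cong (λ z → signPow j * z) (b-expansion k 1≤k _ n n-pent≤n)) (sym (∑-*ˡ (signPow j) vs _))
      where
        n-pent≤n = i-j≤i (+ n) (pent j) {{nonNegative (pent-nonneg j)}}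
    factor : ∀ v → ∑ js (λ j → signPow j * (+ suc v * p ((+ n - pent j) - + (k ℕ.* suc v)))) ≡
                   + suc v * ∑ js (λ j → signPow j * p (remaining k n v - pent j))
    factor v = trans (∑-cong js (λ {j} _ → pointwise j)) (∑-*ˡ (+ suc v) js (λ j → signPow j * p (remaining k n v - pent j)))
      where
        swap-subtrahends : ∀ x a c → (x - a) - c ≡ (x - c) - a
        swap-subtrahends = solve-∀
        *-left-comm : ∀ a b c → a * (b * c) ≡ b * (a * c)
        *-left-comm = solve-∀
        pointwise : ∀ j → signPow j * (+ suc v * p ((+ n - pent j) - + (k ℕ.* suc v))) ≡
                          + suc v * (signPow j * p (remaining k n v - pent j))
        pointwise j = trans (cong (λ z → signPow j * (+ suc v * p z)) (swap-subtrahends (+ n) (pent j) _))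
                            (*-left-comm (signPow j) (+ suc v) _)

𝟙ℤ-self : ∀ n → 𝟙ℤ (+ n - + n) ≡ + 1
𝟙ℤ-self n = cong 𝟙ℤ (+-inverseʳ (+ n))

𝟙ℤ-≢ : ∀ {n a} → a ≢ n → 𝟙ℤ (+ n - + a) ≡ + 0
𝟙ℤ-≢ {n} {a} a≢n with ℕₚ.<-cmp n a
... | tri< n<a _ _ with d , eq ← negative-difference n<a = cong 𝟙ℤ eq
... | tri≈ _ n≡a _ = ⊥-elim (a≢n (sym n≡a))
... | tri> _ _ a<n =
  trans (cong 𝟙ℤ (trans ([+m]-[+n]≡m⊖n n a) (⊖-≥ (ℕₚ.<⇒≤ a<n)))) (𝟙-positive (ℕₚ.m<n⇒0<n∸m a<n))
  where
    𝟙-positive : ∀ {m} → 0 < m → 𝟙 m ≡ + 0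
    𝟙-positive {suc m} _ = refl

iverson-coefficient : ∀ k n → (+ 1 + (- + 1) ^ (iverson-dvd k n ℕ.+ 1)) / + 2 ≡ + iverson-dvd k n
iverson-coefficient k n with does (k ∣? n)
... | true = refl
... | false = refl

divisor-sum : ∀ k n → 1 ℕ.≤ n → .{{_ : ℕ.NonZero k}} →
  + iverson-dvd k n * (+ n / + k) ≡ ∑ (upTo n) (λ v → + suc v * 𝟙ℤ (remaining k n v))
divisor-sum k n 1≤n with k ∣? n in k∣?n
... | no k∤n = sym (∑-zero (upTo n) λ {v} _ →
  trans (cong (λ z → + suc v * z) (𝟙ℤ-≢ (λ kv≡n → k∤n (divides (suc v) (trans (sym kv≡n) (ℕₚ.*-comm k (suc v)))))))
        (*-zeroʳ (+ suc v)))
... | yes (divides zero n≡0) = ⊥-elim (ℕₚ.<⇒≢ 1≤n (sym n≡0))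
... | yes (divides (suc r) n≡qk) = begin
  + 1 * (+ n / + k)                               ≡⟨ *-identityˡ _ ⟩
  + n / + k                                       ≡⟨ div-pos-is-/ℕ (+ n) k ⟩
  + (n ℕ./ k)                                     ≡⟨ cong (λ m → + (m ℕ./ k)) n≡qk ⟩
  + (suc r ℕ.* k ℕ./ k)                           ≡⟨ cong +_ (m*n/n≡m (suc r) k) ⟩
  + suc r                                         ≡⟨ *-identityʳ (+ suc r) ⟨
  + suc r * + 1                                   ≡⟨ cong (λ z → + suc r * z) 𝟙ℤ[n-kq]≡1 ⟨
  + suc r * 𝟙ℤ (remaining k n r)                  ≡⟨ ∑-upTo-single n r _ r<n others ⟨
  ∑ (upTo n) (λ v → + suc v * 𝟙ℤ (remaining k n v)) ∎
  where
    kq≡n : k ℕ.* suc r ≡ n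
    kq≡n = trans (ℕₚ.*-comm k (suc r)) (sym n≡qk)
    𝟙ℤ[n-kq]≡1 : 𝟙ℤ (remaining k n r) ≡ + 1
    𝟙ℤ[n-kq]≡1 = trans (cong (λ a → 𝟙ℤ (+ n - + a)) kq≡n) (𝟙ℤ-self n)
    r<n : r < n
    r<n = subst (r <_) kq≡n (ℕₚ.<-≤-trans (ℕₚ.n<1+n r) (ℕₚ.m≤n*m (suc r) k))
    others : ∀ v → v ≢ r → + suc v * 𝟙ℤ (remaining k n v) ≡ + 0
    others v v≢r = trans (cong (λ z → + suc v * z) (𝟙ℤ-≢ kv≢n)) (*-zeroʳ (+ suc v))
      where
        kv≢n : k ℕ.* suc v ≢ n
        kv≢n kv≡n = v≢r (ℕₚ.suc-injective (ℕₚ.*-cancelˡ-≡ (suc v) (suc r) k (trans kv≡n (sym kq≡n))))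

scale-nonneg : ∀ c {x} → + 0 ≤ x → + 0 ≤ + c * x
scale-nonneg c {x} 0≤x = subst (_≤ + c * x) (*-zeroʳ (+ c)) (*-monoˡ-≤-nonNeg (+ c) 0≤x)

signed-difference : ∀ k i n → 1 ℕ.≤ k → 1 ℕ.≤ n → .{{_ : ℕ.NonZero k}} →
  sign i * (∑ (range (suc i)) (λ j → signPow j * b k (+ n - pent j))
            - ((+ 1 + (- + 1) ^ (iverson-dvd k n ℕ.+ 1)) / + 2) * (+ n / + k))
  ≡ ∑ (upTo n) (λ v → + suc v * (sign i * (truncatedSumℤ i (remaining k n v) - 𝟙ℤ (remaining k n v))))
signed-difference k i n 1≤k 1≤n = begin
  sign i * (∑ (range (suc i)) (λ j → signPow j * b k (+ n - pent j))
            - ((+ 1 + (- + 1) ^ (iverson-dvd k n ℕ.+ 1)) / + 2) * (+ n / + k))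
    ≡⟨ cong₂ (λ S D → sign i * (S - D)) (alternating-b-sum k i n 1≤k)
             (trans (cong (_* (+ n / + k)) (iverson-coefficient k n)) (divisor-sum k n 1≤n)) ⟩
  sign i * (∑ vs (λ v → + suc v * T v) - ∑ vs (λ v → + suc v * D v))
    ≡⟨ cong (λ z → sign i * z) (∑-- vs _ _) ⟨
  sign i * ∑ vs (λ v → + suc v * T v - + suc v * D v)
    ≡⟨ ∑-*ˡ (sign i) vs _ ⟨
  ∑ vs (λ v → sign i * (+ suc v * T v - + suc v * D v))
    ≡⟨ ∑-cong vs (λ {v} _ → regroup (sign i) (+ suc v) (T v) (D v)) ⟩
  ∑ vs (λ v → + suc v * (sign i * (T v - D v)))
    ∎
  where
    vs = upTo n
    T = λ v → truncatedSumℤ i (remaining k n v)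
    D = λ v → 𝟙ℤ (remaining k n v)
    regroup : ∀ s c t d → s * (c * t - c * d) ≡ c * (s * (t - d))
    regroup = solve-∀

corollary2p6 : (k ℓ n : ℕ) → 1 ℕ.≤ k → 1 ℕ.≤ ℓ → 1 ℕ.≤ n →
    .{{_ : ℕ.NonZero k}} →
    + 0 ≤ (- + 1) ^ (ℓ ∸ 1) * (sumℤ (map (λ j → signPow j * b k (+ n - pent j)) (range ℓ)) - ((+ 1 + (- + 1) ^ (iverson-dvd k n ℕ.+ 1)) / + 2) * (+ n / + k))
corollary2p6 k (suc i) n 1≤k _ 1≤n =
  subst (+ 0 ≤_) (sym (signed-difference k i n 1≤k 1≤n))
        (∑-nonneg (upTo n) (λ v → scale-nonneg (suc v) (truncatedSumℤ-sign i (remaining k n v))))
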